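{- Let $g,p,d$ be positive integers with $p\ge 2$, and let $E_{g,p,d}$ be the "staircase with landing" configuration consisting of the following $g+p+d$ cells: the cells $G_i=[i-1,i]\times[-i,-i+1]$ for $1\le i\le g$ (a descending staircase); the cells $P_j=[g+j-1,g+j]\times[-g-1,-g]$ for $1\le j\le p$ (a horizontal landing, whose first cell $P_1$ touches $G_g$ only at the corner $(g,-g)$); and the cells $D_k=[g+p+k-1,g+p+k]\times[-g-1-k,-g-k]$ for $1\le k\le d$ (a second descending staircase, whose first cell $D_1$ touches $P_p$ only at the corner $(g+p,-g-1)$). Then: (i) if $g=d=1$, $E_{g,p,d}$ is strongly embroiderable; (ii) if $g=1$ and $d>1$, $E_{g,p,d}$ is embroiderable but not strongly embroiderable; (iii) if $d=1$ and $g>1$, $E_{g,p,d}$ is embroiderable but not strongly embroiderable; (iv) if $g>1$ and $d>1$, $E_{g,p,d}$ is not strongly embroiderable, and it is embroiderable if and only if $p$ is odd.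
   Context: Vertices are the points of $\mathbb Z^2$; a cell is a square $[a,a+1]\times[b,b+1]$ with $(a,b)\in\mathbb Z^2$; a configuration is a finite set of cells. Two vertices are adjacent if at distance $1$. The lower diagonal of a cell joins its top-right corner to its bottom-left corner; the upper diagonal joins its top-left corner to its bottom-right corner. An embroidery of a configuration $C$ with $n$ cells is a sequence of points $x_0,\dots,x_{4n-1}\in\mathbb Z^2$ such that the front stitches $[x_{2k},x_{2k+1}]$ ($0\le k\le 2n-1$) are exactly the $2n$ diagonals of the cells of $C$, each once (in either direction); the back stitches $[x_{2k+1},x_{2k+2}]$ ($0\le k\le 2n-2$) satisfy $x_{2k+1}\ne x_{2k+2}$; and for each cell its lower diagonal is stitched before its upper diagonal. $C$ is embroiderable if it has an embroidery of total thread length $2n(1+\sqrt2)-1$, i.e. every back stitch joins two adjacent vertices. $C$ is strongly embroiderable if it has an embroidery in which every back stitch joins adjacent vertices and additionally $x_{4n-1}$ is adjacent to $x_0$ (thread length $2n(1+\sqrt2)$ returning to the start). -}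

module Defs where

open import Data.Nat as ℕ using (ℕ; zero; suc; _<_; _∸_)
open import Data.Integer as ℤ using (ℤ; +_; -[1+_])
open import Data.Fin using (Fin; toℕ)
open import Data.Product using (_×_; _,_; proj₁; proj₂)
open import Data.Sum using (_⊎_)
open import Data.List using (List; length; lookup; map; upTo; _++_)
open import Function.Definitions using (Bijective)
open import Relation.Binary.PropositionalEquality using (_≡_)

Point : Set
Point = ℤ × ℤ

-- A cell [a,a+1]×[b,b+1] is represented by its bottom-left corner (a,b).
Cell : Set
Cell = ℤ × ℤ

Config : Set
Config = List Cell

Adjacent : Point → Point → Set
Adjacent (a , b) (c , d) = (a ℤ.- c) ℤ.* (a ℤ.- c) ℤ.+ (b ℤ.- d) ℤ.* (b ℤ.- d) ≡ + 1

data Diag : Set where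
  lower upper : Diag

diagEnds : Cell → Diag → Point × Point
diagEnds (a , b) lower = ((a ℤ.+ + 1) , (b ℤ.+ + 1)) , (a , b)
diagEnds (a , b) upper = (a , (b ℤ.+ + 1)) , ((a ℤ.+ + 1) , b)

SameSeg : Point → Point → Point × Point → Set
SameSeg p q (u , v) = (p ≡ u × q ≡ v) ⊎ (p ≡ v × q ≡ u)

-- An embroidery of C (n = length C) with every back stitch between adjacent
-- vertices. The sequence x₀,…,x_{4n-1} is given by x (values beyond 4n-1 are
-- irrelevant). σ k is the diagonal (cell index, type) sewn by the front stitch
-- [x_{2k}, x_{2k+1}]; σ bijective = every diagonal stitched exactly once.
record AdjEmbroidery (C : Config) : Set where
  field
    x     : ℕ → Point
    σ     : Fin (2 ℕ.* length C) → Fin (length C) × Diag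
    σ-bij : Bijective _≡_ _≡_ σ
    front : ∀ k → SameSeg (x (2 ℕ.* toℕ k)) (x (suc (2 ℕ.* toℕ k)))
                          (diagEnds (lookup C (proj₁ (σ k))) (proj₂ (σ k)))
    lowerFirst : ∀ k k' i → σ k ≡ (i , lower) → σ k' ≡ (i , upper) → toℕ k < toℕ k'
    back  : ∀ k → k < 2 ℕ.* length C ∸ 1 →
              Adjacent (x (suc (2 ℕ.* k))) (x (2 ℕ.+ 2 ℕ.* k))

Embroiderable : Config → Set
Embroiderable C = AdjEmbroidery C

StronglyEmbroiderable : Config → Set
StronglyEmbroiderable C =
  Data.Product.Σ (AdjEmbroidery C) λ e →
    Adjacent (AdjEmbroidery.x e (4 ℕ.* length C ∸ 1)) (AdjEmbroidery.x e 0)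

-- G_i = [i-1,i]×[-i,-i+1], i = i'+1, i' < g
-- P_j = [g+j-1,g+j]×[-g-1,-g], j = j'+1, j' < p
-- D_k = [g+p+k-1,g+p+k]×[-g-1-k,-g-k], k = k'+1, k' < d
staircase : ℕ → ℕ → ℕ → Config
staircase g p d =
  map (λ i → (+ i) , -[1+ i ]) (upTo g) ++
  map (λ j → (+ (g ℕ.+ j)) , -[1+ g ]) (upTo p) ++
  map (λ k → (+ (g ℕ.+ p ℕ.+ k)) , -[1+ (suc g ℕ.+ k) ]) (upTo d)

module Submission where

-- Vertices are read in natural coordinates (u , v) ↦ (u , -v); unit back
-- stitches become the four unit moves `_∼_` and an embroidery becomes a
-- `Stitching`, a sequence of front stitches (diagonal, start, finish).
-- The negative results rest on three general lemmas about stitchings: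
--   parity      a unit step changes the colour u + v mod 2, a diagonal keeps
--               it, so the last front stitch starts on the opposite colour;
--   end cell    the thread starts with the lower diagonal of an end cell of a
--               staircase or finishes with its upper diagonal;
--   cut vertex  the thread cannot start and finish on the same side of a
--               vertex where the configuration meets itself in a corner.
-- Their local hypotheses for E_{g,p,d} are decided by computation on a small
-- translated window.  For g ≥ 2 (d ≥ 2) a closed thread starts and ends next
-- to the first (last) cell, against the cut vertex (g , g) ((g + p , g + 1));
-- for g, d ≥ 2 the thread runs between the two end cells and parity forces p
-- odd.  The embroideries are explicit plans, lists of stitches built from
-- runs along staircases and rows.

open import Defs
open import Data.Nat as ℕ
  using (ℕ; zero; suc; _+_; _*_; _∸_; _≤_; _<_; _%_; z≤n; s≤s; _<?_; _≟_; _<ᵇ_)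
import Data.Nat.Properties as ℕP
open import Data.Nat.Tactic.RingSolver using (solve-∀)
open import Data.Integer as ℤ using (ℤ; +_; -[1+_]; _⊖_; ∣_∣)
import Data.Integer.Properties as ℤP
open import Data.Integer.Tactic.RingSolver renaming (solve-∀ to solveℤ-∀)
open import Data.Fin as Fin using (Fin; toℕ; fromℕ<)
import Data.Fin.Properties as FinP
open import Data.Bool using (Bool; true; false; not; if_then_else_; T)
open import Data.Bool.Properties using (not-involutive)
open import Data.Unit using (⊤; tt)
open import Data.Empty using (⊥; ⊥-elim)
open import Data.Product using (_×_; _,_; proj₁; proj₂; Σ; ∃)
open import Data.Sum using (_⊎_; inj₁; inj₂)
open import Data.List using (List; []; _∷_; length; lookup; map; upTo; applyUpTo; _++_)
import Data.List.Properties as ListP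
open import Data.List.Membership.Propositional using (_∈_)
open import Data.List.Relation.Unary.Any using (Any; here; there)
open import Data.List.Relation.Unary.All using (All; []; _∷_)
import Data.List.Relation.Unary.All.Properties as AllP
import Data.List.Relation.Unary.Any.Properties as AnyP
open import Relation.Binary.PropositionalEquality
open import Relation.Nullary using (¬_; Dec; yes; no)
open import Relation.Nullary.Decidable using (_×-dec_; _⊎-dec_; _→-dec_; True; toWitness)
open import Relation.Binary.Definitions using (DecidableEquality)
open import Data.Product.Properties using () renaming (≡-dec to ×-≡-dec)
open import Data.List.Membership.Propositional.Properties using (∈-map⁺)
open import Function.Bundles using (_⇔_; mk⇔)

-- Vertices of the fourth quadrant in natural coordinates: (u , v) stands for
-- the point (u , -v), so u grows to the right and v grows downwards, as the
-- staircase does.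
Pt : Set
Pt = ℕ × ℕ

toPoint : Pt → Point
toPoint (u , v) = (+ u , ℤ.- (+ v))

_∼_ : Pt → Pt → Set
(u , v) ∼ (u' , v') =
  (u' ≡ suc u × v ≡ v') ⊎ (u ≡ suc u' × v ≡ v') ⊎ (u ≡ u' × v' ≡ suc v) ⊎ (u ≡ u' × v ≡ suc v')

pattern east  e f = inj₁ (e , f)
pattern west  e f = inj₂ (inj₁ (e , f))
pattern south e f = inj₂ (inj₂ (inj₁ (e , f)))
pattern north e f = inj₂ (inj₂ (inj₂ (e , f)))

∼-sym : ∀ {A B} → A ∼ B → B ∼ A
∼-sym (east e f)  = west e (sym f)
∼-sym (west e f)  = east e (sym f)
∼-sym (south e f) = north (sym e) f
∼-sym (north e f) = south (sym e) f

module IntegerDistance where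
  dist : ℕ → ℕ → ℕ
  dist u u' = ∣ u ⊖ u' ∣

  squared : ∀ i → i ℤ.* i ≡ + (∣ i ∣ * ∣ i ∣)
  squared (+ n)    = ℤP.+◃n≡+n (n * n)
  squared -[1+ n ] = ℤP.+◃n≡+n (suc n * suc n)

  adjacent≡ : ∀ u v u' v' → Adjacent (toPoint (u , v)) (toPoint (u' , v'))
              ≡ (+ (dist u u' * dist u u' + dist v' v * dist v' v) ≡ + 1)
  adjacent≡ u v u' v' = cong (_≡ + 1) (begin
    (+ u ℤ.- + u') ℤ.* (+ u ℤ.- + u') ℤ.+ (ℤ.- + v ℤ.- ℤ.- + v') ℤ.* (ℤ.- + v ℤ.- ℤ.- + v')
      ≡⟨ cong (λ z → (+ u ℤ.- + u') ℤ.* (+ u ℤ.- + u') ℤ.+ z ℤ.* z) (negDiff (+ v) (+ v')) ⟩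
    (+ u ℤ.- + u') ℤ.* (+ u ℤ.- + u') ℤ.+ (+ v' ℤ.- + v) ℤ.* (+ v' ℤ.- + v)
      ≡⟨ cong₂ (λ a b → a ℤ.* a ℤ.+ b ℤ.* b) (ℤP.m-n≡m⊖n u u') (ℤP.m-n≡m⊖n v' v) ⟩
    (u ⊖ u') ℤ.* (u ⊖ u') ℤ.+ (v' ⊖ v) ℤ.* (v' ⊖ v)
      ≡⟨ cong₂ ℤ._+_ (squared (u ⊖ u')) (squared (v' ⊖ v)) ⟩
    + (dist u u' * dist u u') ℤ.+ + (dist v' v * dist v' v)
      ≡⟨ sym (ℤP.pos-+ (dist u u' * dist u u') _) ⟩
    + (dist u u' * dist u u' + dist v' v * dist v' v) ∎)
    where
    open ≡-Reasoning
    negDiff : ∀ (x y : ℤ) → ℤ.- x ℤ.- ℤ.- y ≡ y ℤ.- x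
    negDiff = solveℤ-∀

  unitSquares : ∀ a b → a * a + b * b ≡ 1 → (a ≡ 1 × b ≡ 0) ⊎ (a ≡ 0 × b ≡ 1)
  unitSquares 0 1 _ = inj₂ (refl , refl)
  unitSquares 1 0 _ = inj₁ (refl , refl)
  unitSquares 0 0 ()
  unitSquares 0 (suc (suc b)) ()
  unitSquares 1 (suc b) ()
  unitSquares (suc (suc a)) b ()

  dist≡0 : ∀ u u' → dist u u' ≡ 0 → u ≡ u'
  dist≡0 u u' e with u ℕ.≤? u'
  ... | yes u≤u' rewrite ℤP.⊖-≤ u≤u' =
    sym (ℕP.≤-antisym (ℕP.m∸n≡0⇒m≤n (trans (sym (ℤP.∣-i∣≡∣i∣ (+ (u' ∸ u)))) e)) u≤u')
  ... | no u≰u' rewrite ℤP.⊖-≥ (ℕP.≰⇒≥ u≰u') = ℕP.≤-antisym (ℕP.m∸n≡0⇒m≤n e) (ℕP.≰⇒≥ u≰u')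

  dist≡1 : ∀ u u' → dist u u' ≡ 1 → u ≡ suc u' ⊎ u' ≡ suc u
  dist≡1 u u' e with u ℕ.≤? u'
  ... | yes u≤u' rewrite ℤP.⊖-≤ u≤u' =
    inj₂ (trans (sym (ℕP.m∸n+n≡m u≤u')) (cong (_+ u) (trans (sym (ℤP.∣-i∣≡∣i∣ (+ (u' ∸ u)))) e)))
  ... | no u≰u' rewrite ℤP.⊖-≥ (ℕP.≰⇒≥ u≰u') =
    inj₁ (trans (sym (ℕP.m∸n+n≡m (ℕP.≰⇒≥ u≰u'))) (cong (_+ u') e))

  dist-refl : ∀ n → dist n n ≡ 0
  dist-refl n rewrite ℤP.n⊖n≡0 n = refl

  dist-suc : ∀ n → dist (suc n) n ≡ 1
  dist-suc n rewrite ℤP.⊖-≥ (ℕP.n≤1+n n) | ℕP.m+n∸n≡m 1 n = refl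

  dist-suc' : ∀ n → dist n (suc n) ≡ 1
  dist-suc' n = trans (ℤP.∣m⊖n∣≡∣n⊖m∣ n (suc n)) (dist-suc n)

  adjacent⇒∼ : ∀ A B → Adjacent (toPoint A) (toPoint B) → A ∼ B
  adjacent⇒∼ (u , v) (u' , v') adj
    with unitSquares (dist u u') (dist v' v) (ℤP.+-injective (subst (λ X → X) (adjacent≡ u v u' v') adj))
  ... | inj₁ (du , dv) = horizontal (dist≡1 u u' du) (sym (dist≡0 v' v dv))
    where
    horizontal : u ≡ suc u' ⊎ u' ≡ suc u → v ≡ v' → (u , v) ∼ (u' , v')
    horizontal (inj₁ e) f = west e f
    horizontal (inj₂ e) f = east e f
  ... | inj₂ (du , dv) = vertical (dist≡0 u u' du) (dist≡1 v' v dv)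
    where
    vertical : u ≡ u' → v' ≡ suc v ⊎ v ≡ suc v' → (u , v) ∼ (u' , v')
    vertical e (inj₁ f) = south e f
    vertical e (inj₂ f) = north e f

  ∼⇒adjacent : ∀ A B → A ∼ B → Adjacent (toPoint A) (toPoint B)
  ∼⇒adjacent (u , v) (u' , v') a = subst (λ X → X) (sym (adjacent≡ u v u' v')) (unit a)
    where
    sq1 : ∀ {a b} → a ≡ 1 → b ≡ 0 → + (a * a + b * b) ≡ + 1
    sq1 refl refl = refl
    sq1' : ∀ {a b} → a ≡ 0 → b ≡ 1 → + (a * a + b * b) ≡ + 1
    sq1' refl refl = refl
    unit : (u , v) ∼ (u' , v') → + (dist u u' * dist u u' + dist v' v * dist v' v) ≡ + 1
    unit (east refl refl)  = sq1 (dist-suc' u) (dist-refl v)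
    unit (west refl refl)  = sq1 (dist-suc u') (dist-refl v)
    unit (south refl refl) = sq1' (dist-refl u) (dist-suc v)
    unit (north refl refl) = sq1' (dist-refl u) (dist-suc' v')

open IntegerDistance using (adjacent⇒∼; ∼⇒adjacent)

-- Cells of the staircase are numbered 0,…,g+p+d-1 from left to right; cell m
-- occupies the column [m , m+1] and its top edge lies at depth `depth g p m`:
-- depth m = m on the first staircase, g on the landing, g+1+k on the cell D_{k+1}.
depth : ℕ → ℕ → ℕ → ℕ
depth g p m = if m <ᵇ g then m else (if m <ᵇ g + p then g else suc g + (m ∸ (g + p)))

depth-G : ∀ g p m → m < g → depth g p m ≡ m
depth-G g p m m<g with m <ᵇ g | ℕP.<⇒<ᵇ m<g
... | true | _ = refl

depth-P : ∀ g p m → g ≤ m → m < g + p → depth g p m ≡ g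
depth-P g p m g≤m m<g+p with m <ᵇ g | ℕP.<ᵇ⇒< m g
... | true  | m<g = ⊥-elim (ℕP.<⇒≱ (m<g tt) g≤m)
... | false | _ with m <ᵇ g + p | ℕP.<⇒<ᵇ m<g+p
...   | true | _ = refl

depth-D : ∀ g p m → g + p ≤ m → depth g p m ≡ suc g + (m ∸ (g + p))
depth-D g p m g+p≤m with m <ᵇ g | ℕP.<ᵇ⇒< m g
... | true  | m<g = ⊥-elim (ℕP.<⇒≱ (m<g tt) (ℕP.≤-trans (ℕP.m≤m+n g p) g+p≤m))
... | false | _ with m <ᵇ g + p | ℕP.<ᵇ⇒< m (g + p)
...   | true  | m<g+p = ⊥-elim (ℕP.<⇒≱ (m<g+p tt) g+p≤m)
...   | false | _ = refl

depth-landing : ∀ g p j → j < p → depth g p (g + j) ≡ g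
depth-landing g p j j<p = depth-P g p (g + j) (ℕP.m≤m+n g j) (ℕP.+-monoʳ-< g j<p)

depth-second : ∀ g p k → depth g p (g + p + k) ≡ suc g + k
depth-second g p k =
  trans (depth-D g p (g + p + k) (ℕP.m≤m+n (g + p) k)) (cong (λ z → suc g + z) (ℕP.m+n∸m≡n (g + p) k))

depth≤g : ∀ g p m → m < g + p → depth g p m ≤ g
depth≤g g p m m<g+p with m <? g
... | yes m<g = subst (_≤ g) (sym (depth-G g p m m<g)) (ℕP.<⇒≤ m<g)
... | no  m≮g = ℕP.≤-reflexive (depth-P g p m (ℕP.≮⇒≥ m≮g) m<g+p)

depth>g : ∀ g p m → g + p ≤ m → suc g ≤ depth g p m
depth>g g p m g+p≤m = subst (suc g ≤_) (sym (depth-D g p m g+p≤m)) (ℕP.m≤m+n (suc g) _)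

depth≥g : ∀ g p m → g ≤ m → g ≤ depth g p m
depth≥g g p m g≤m with m <? g + p
... | yes m<g+p = ℕP.≤-reflexive (sym (depth-P g p m g≤m m<g+p))
... | no  m≮g+p = ℕP.≤-trans (ℕP.n≤1+n g) (depth>g g p m (ℕP.≮⇒≥ m≮g+p))

cellAt : ℕ → ℕ → ℕ → Cell
cellAt g p m = (+ m , -[1+ depth g p m ])

module Tabulation where
  Tabulates : List Cell → (ℕ → Cell) → Set
  Tabulates xs f = ∀ i → lookup xs i ≡ f (toℕ i)

  tab-map : ∀ (h : ℕ → Cell) (k : ℕ → ℕ) a → Tabulates (map h (applyUpTo k a)) (λ j → h (k j))
  tab-map h k (suc a) Fin.zero    = refl
  tab-map h k (suc a) (Fin.suc i) = tab-map h (λ j → k (suc j)) a i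

  tab-++ : ∀ xs ys f → Tabulates xs f → Tabulates ys (λ j → f (length xs + j)) → Tabulates (xs ++ ys) f
  tab-++ []       ys f tx ty i           = ty i
  tab-++ (x ∷ xs) ys f tx ty Fin.zero    = tx Fin.zero
  tab-++ (x ∷ xs) ys f tx ty (Fin.suc i) = tab-++ xs ys (λ j → f (suc j)) (λ i → tx (Fin.suc i)) ty i

  tab-ext : ∀ xs f f' → Tabulates xs f → (∀ m → m < length xs → f m ≡ f' m) → Tabulates xs f'
  tab-ext xs f f' t e i = trans (t i) (e (toℕ i) (FinP.toℕ<n i))

  length-map-upTo : ∀ (h : ℕ → Cell) a → length (map h (upTo a)) ≡ a
  length-map-upTo h a = trans (ListP.length-map h (upTo a)) (ListP.length-upTo a)

  length-staircase : ∀ g p d → length (staircase g p d) ≡ g + (p + d)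
  length-staircase g p d = begin
    length (Gs ++ Ps ++ Ds)                  ≡⟨ ListP.length-++ Gs ⟩
    length Gs + length (Ps ++ Ds)            ≡⟨ cong (λ z → length Gs + z) (ListP.length-++ Ps) ⟩
    length Gs + (length Ps + length Ds)      ≡⟨ cong₂ (λ a b → a + b) (length-map-upTo _ g)
                                                  (cong₂ _+_ (length-map-upTo _ p) (length-map-upTo _ d)) ⟩
    g + (p + d) ∎
    where
    open ≡-Reasoning
    Gs = map (λ i → (+ i) , -[1+ i ]) (upTo g)
    Ps = map (λ j → (+ (g + j)) , -[1+ g ]) (upTo p)
    Ds = map (λ k → (+ (g + p + k)) , -[1+ (suc g + k) ]) (upTo d)

  lookup-staircase : ∀ g p d → Tabulates (staircase g p d) (cellAt g p)
  lookup-staircase g p d = tab-++ Gs (Ps ++ Ds) (cellAt g p) tG (tab-++ Ps Ds (λ j → cellAt g p (length Gs + j)) tP tD)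
    where
    Gs = map (λ i → (+ i) , -[1+ i ]) (upTo g)
    Ps = map (λ j → (+ (g + j)) , -[1+ g ]) (upTo p)
    Ds = map (λ k → (+ (g + p + k)) , -[1+ (suc g + k) ]) (upTo d)
    |Gs| = length-map-upTo (λ i → (+ i) , -[1+ i ]) g
    |Ps| = length-map-upTo (λ j → (+ (g + j)) , -[1+ g ]) p
    tG : Tabulates Gs (cellAt g p)
    tG = tab-ext Gs _ _ (tab-map _ (λ j → j) g) λ m m< →
           cong (λ z → (+ m , -[1+ z ])) (sym (depth-G g p m (subst (m <_) |Gs| m<)))
    tP : Tabulates Ps (λ j → cellAt g p (length Gs + j))
    tP = tab-ext Ps _ _ (tab-map _ (λ j → j) p) λ m m< →
           cong₂ (λ a b → (+ a , -[1+ b ])) (cong (_+ m) (sym |Gs|))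
             (sym (trans (cong (λ z → depth g p (z + m)) |Gs|)
                         (depth-landing g p m (subst (m <_) |Ps| m<))))
    tD : Tabulates Ds (λ j → cellAt g p (length Gs + (length Ps + j)))
    tD = tab-ext Ds _ _ (tab-map _ (λ j → j) d) λ m _ →
           let e : length Gs + (length Ps + m) ≡ g + p + m
               e = trans (cong₂ (λ a b → a + (b + m)) |Gs| |Ps|) (sym (ℕP.+-assoc g p m)) in
           cong₂ (λ a b → (+ a , -[1+ b ])) (sym e) (sym (trans (cong (depth g p) e) (depth-second g p m)))

open Tabulation using (length-staircase; lookup-staircase)

-- A diagonal is named by its key (cell , type).  `ends D κ` lists its two
-- endpoints when cell m has its top edge at depth D m.
Key : Set
Key = ℕ × Diag

ends : (ℕ → ℕ) → Key → Pt × Pt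
ends D (m , lower) = ((m + 1 , D m) , (m , suc (D m)))
ends D (m , upper) = ((m , D m) , (m + 1 , suc (D m)))

toPoints : Pt × Pt → Point × Point
toPoints (A , B) = (toPoint A , toPoint B)

top-edge : ∀ D → -[1+ D ] ℤ.+ + 1 ≡ ℤ.- (+ D)
top-edge zero    = refl
top-edge (suc D) = refl

diagEnds-cellAt : ∀ g p m δ → diagEnds (cellAt g p m) δ ≡ toPoints (ends (depth g p) (m , δ))
diagEnds-cellAt g p m lower = cong (λ z → ((+ (m + 1) , z) , (+ m , -[1+ depth g p m ]))) (top-edge (depth g p m))
diagEnds-cellAt g p m upper = cong (λ z → ((+ m , z) , (+ (m + 1) , -[1+ depth g p m ]))) (top-edge (depth g p m))

Traverses : Pt → Pt → Pt × Pt → Set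
Traverses A B (P , Q) = (A ≡ P × B ≡ Q) ⊎ (A ≡ Q × B ≡ P)

IsEnd : (ℕ → ℕ) → Pt → Key → Set
IsEnd D w κ = w ≡ proj₁ (ends D κ) ⊎ w ≡ proj₂ (ends D κ)

start-isEnd : ∀ {A B} E → Traverses A B E → A ≡ proj₁ E ⊎ A ≡ proj₂ E
start-isEnd E (inj₁ (e , _)) = inj₁ e
start-isEnd E (inj₂ (e , _)) = inj₂ e

finish-isEnd : ∀ {A B} E → Traverses A B E → B ≡ proj₁ E ⊎ B ≡ proj₂ E
finish-isEnd E (inj₁ (_ , e)) = inj₂ e
finish-isEnd E (inj₂ (_ , e)) = inj₁ e

orient : ∀ {A B J₀ J₁ : Pt} {E} → Traverses A B E → E ≡ (J₀ , J₁) ⊎ E ≡ (J₁ , J₀) →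
         (A ≡ J₀ × B ≡ J₁) ⊎ (A ≡ J₁ × B ≡ J₀)
orient s (inj₁ refl) = s
orient (inj₁ (a , b)) (inj₂ refl) = inj₂ (a , b)
orient (inj₂ (a , b)) (inj₂ refl) = inj₁ (a , b)

-- An embroidery of a configuration of n cells at depths D, read in natural
-- coordinates: front stitch k < 2n sews the diagonal `key k` from `start k`
-- to `finish k`, and every back stitch is a unit step.
record Stitching (n : ℕ) (D : ℕ → ℕ) : Set where
  field
    key            : ℕ → Key
    start finish   : ℕ → Pt
    key-cell       : ∀ k → k < 2 * n → proj₁ (key k) < n
    front          : ∀ k → k < 2 * n → Traverses (start k) (finish k) (ends D (key k))
    back           : ∀ k → suc k < 2 * n → finish k ∼ start (suc k)
    key-injective  : ∀ k k' → k < 2 * n → k' < 2 * n → key k ≡ key k' → k ≡ k'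
    lowerFirst     : ∀ k k' c → k < 2 * n → k' < 2 * n →
                     key k ≡ (c , lower) → key k' ≡ (c , upper) → k < k'
    key-surjective : ∀ c δ → c < n → ∃ λ k → k < 2 * n × key k ≡ (c , δ)

Closed : ∀ {n D} → Stitching n D → Set
Closed {n} S = Stitching.finish S (2 * n ∸ 1) ∼ Stitching.start S 0

-- Thread indices: the last point x_{4n-1} of the thread is the finish of
-- front stitch 2n - 1.
last-index : ∀ n → 0 < n → suc (2 * (2 * n ∸ 1)) ≡ 4 * n ∸ 1
last-index (suc m) _ =
  trans (cong (λ z → suc (2 * (z ∸ 1))) (twice m)) (trans (odd m) (sym (cong (_∸ 1) (four m))))
  where
  twice : ∀ m → 2 * suc m ≡ suc (suc (2 * m))
  twice = solve-∀
  four : ∀ m → 4 * suc m ≡ suc (suc (suc (suc (4 * m))))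
  four = solve-∀
  odd : ∀ m → suc (2 * suc (2 * m)) ≡ suc (suc (suc (4 * m)))
  odd = solve-∀

module FromEmbroidery {g p d : ℕ} (em : AdjEmbroidery (staircase g p d)) where
  open AdjEmbroidery em
  n = length (staircase g p d)

  extend : ∀ {X : Set} {N} → (Fin N → X) → X → ℕ → X
  extend {N = N} f x₀ k with k <? N
  ... | yes k<N = f (fromℕ< k<N)
  ... | no  _   = x₀

  extend-< : ∀ {X : Set} {N} (f : Fin N → X) x₀ k (k<N : k < N) → extend f x₀ k ≡ f (fromℕ< k<N)
  extend-< {N = N} f x₀ k k<N with k <? N
  ... | yes _   = refl
  ... | no  k≮N = ⊥-elim (k≮N k<N)

  keyF : Fin (2 * n) → Key
  keyF k = toℕ (proj₁ (σ k)) , proj₂ (σ k)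

  frontF : ∀ k → SameSeg (x (2 * toℕ k)) (x (suc (2 * toℕ k))) (toPoints (ends (depth g p) (keyF k)))
  frontF k = subst (SameSeg (x (2 * toℕ k)) (x (suc (2 * toℕ k))))
               (trans (cong (λ c → diagEnds c (proj₂ (σ k))) (lookup-staircase g p d (proj₁ (σ k))))
                      (diagEnds-cellAt g p (toℕ (proj₁ (σ k))) (proj₂ (σ k))))
               (front k)

  oriented : ∀ X Y E → SameSeg X Y (toPoints E) →
             Σ (Pt × Pt) λ AB → X ≡ toPoint (proj₁ AB) × Y ≡ toPoint (proj₂ AB) × Traverses (proj₁ AB) (proj₂ AB) E
  oriented X Y (P , Q) (inj₁ (x≡ , y≡)) = (P , Q) , x≡ , y≡ , inj₁ (refl , refl)
  oriented X Y (P , Q) (inj₂ (x≡ , y≡)) = (Q , P) , x≡ , y≡ , inj₂ (refl , refl)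

  module _ (k : Fin (2 * n)) where
    orientedF = oriented _ _ _ (frontF k)
    startF finishF : Pt
    startF  = proj₁ (proj₁ orientedF)
    finishF = proj₂ (proj₁ orientedF)

  keyN = extend keyF (0 , lower)
  startN = extend startF (0 , 0)
  finishN = extend finishF (0 , 0)

  x-start : ∀ k (k< : k < 2 * n) → x (2 * k) ≡ toPoint (startN k)
  x-start k k< rewrite extend-< startF (0 , 0) k k< =
    subst (λ j → x (2 * j) ≡ toPoint (startF (fromℕ< k<))) (FinP.toℕ-fromℕ< k<)
      (proj₁ (proj₂ (orientedF (fromℕ< k<))))

  x-finish : ∀ k (k< : k < 2 * n) → x (suc (2 * k)) ≡ toPoint (finishN k)
  x-finish k k< rewrite extend-< finishF (0 , 0) k k< =
    subst (λ j → x (suc (2 * j)) ≡ toPoint (finishF (fromℕ< k<))) (FinP.toℕ-fromℕ< k<)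
      (proj₁ (proj₂ (proj₂ (orientedF (fromℕ< k<)))))

  keyN-< : ∀ k (k< : k < 2 * n) → keyN k ≡ keyF (fromℕ< k<)
  keyN-< = extend-< keyF (0 , lower)

  keyF-injective : ∀ {k k'} → keyF k ≡ keyF k' → k ≡ k'
  keyF-injective e = proj₁ σ-bij (cong₂ _,_ (FinP.toℕ-injective (cong proj₁ e)) (cong proj₂ e))

  stitching : Stitching n (depth g p)
  stitching = record
    { key = keyN ; start = startN ; finish = finishN
    ; key-cell = λ k k< → subst (λ κ → proj₁ κ < n) (sym (keyN-< k k<)) (FinP.toℕ<n (proj₁ (σ (fromℕ< k<))))
    ; front = front′
    ; back = back′
    ; key-injective = λ k k' k< k'< e →
        trans (sym (FinP.toℕ-fromℕ< k<))
          (trans (cong toℕ (keyF-injective (trans (sym (keyN-< k k<)) (trans e (keyN-< k' k'<)))))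
                 (FinP.toℕ-fromℕ< k'<))
    ; lowerFirst = lowerFirst′
    ; key-surjective = surjective
    }
    where
    front′ : ∀ k → k < 2 * n → Traverses (startN k) (finishN k) (ends (depth g p) (keyN k))
    front′ k k< = subst (λ κ → Traverses (startN k) (finishN k) (ends (depth g p) κ)) (sym (keyN-< k k<))
      (subst₂ (λ A B → Traverses A B (ends (depth g p) (keyF (fromℕ< k<))))
         (sym (extend-< startF (0 , 0) k k<)) (sym (extend-< finishF (0 , 0) k k<))
         (proj₂ (proj₂ (proj₂ (orientedF (fromℕ< k<))))))

    back′ : ∀ k → suc k < 2 * n → finishN k ∼ startN (suc k)
    back′ k sk< = adjacent⇒∼ (finishN k) (startN (suc k))
      (subst₂ Adjacent (x-finish k (ℕP.<-trans (ℕP.n<1+n k) sk<))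
                       (trans (cong x (cong suc (sym (ℕP.+-suc k (k + 0))))) (x-start (suc k) sk<))
        (back k (ℕP.∸-monoˡ-≤ 1 sk<)))

    lowerFirst′ : ∀ k k' c → k < 2 * n → k' < 2 * n → keyN k ≡ (c , lower) → keyN k' ≡ (c , upper) → k < k'
    lowerFirst′ k k' c k< k'< e e' = subst₂ _<_ (FinP.toℕ-fromℕ< k<) (FinP.toℕ-fromℕ< k'<)
      (lowerFirst (fromℕ< k<) (fromℕ< k'<) (proj₁ (σ (fromℕ< k<)))
        (cong (proj₁ (σ (fromℕ< k<)) ,_) (cong proj₂ l))
        (cong₂ _,_ (FinP.toℕ-injective (trans (cong proj₁ u) (sym (cong proj₁ l)))) (cong proj₂ u)))
      where
      l = trans (sym (keyN-< k k<)) e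
      u = trans (sym (keyN-< k' k'<)) e'

    surjective : ∀ c δ → c < n → ∃ λ k → k < 2 * n × keyN k ≡ (c , δ)
    surjective c δ c< with proj₂ σ-bij (fromℕ< c< , δ)
    ... | k , hit = toℕ k , FinP.toℕ<n k ,
          trans (keyN-< (toℕ k) (FinP.toℕ<n k))
            (trans (cong keyF (FinP.fromℕ<-toℕ k (FinP.toℕ<n k)))
               (cong₂ _,_ (trans (cong (λ z → toℕ (proj₁ z)) (hit refl)) (FinP.toℕ-fromℕ< c<))
                          (cong proj₂ (hit refl))))

  stitching-closed : 0 < n → Adjacent (x (4 * n ∸ 1)) (x 0) → Closed stitching
  stitching-closed n>0 adj = adjacent⇒∼ (finishN (2 * n ∸ 1)) (startN 0)
    (subst₂ Adjacent (trans (cong x (sym (last-index n n>0))) (x-finish (2 * n ∸ 1) last<)) (x-start 0 0<2n) adj)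
    where
    0<2n : 0 < 2 * n
    0<2n = ℕP.<-≤-trans n>0 (ℕP.m≤m+n n (n + 0))
    last< : 2 * n ∸ 1 < 2 * n
    last< = ℕP.∸-monoʳ-< {o = 0} (s≤s z≤n) 0<2n

stitchingOf : ∀ g p d → AdjEmbroidery (staircase g p d) → Stitching (g + (p + d)) (depth g p)
stitchingOf g p d em = subst (λ n → Stitching n (depth g p)) (length-staircase g p d) (FromEmbroidery.stitching {g} {p} {d} em)

stitchingOf-closed : ∀ g p d → 0 < g → (se : StronglyEmbroiderable (staircase g p d)) →
                     Closed (stitchingOf g p d (proj₁ se))
stitchingOf-closed g p d g>0 (em , adj) =
  transport (length-staircase g p d) (FromEmbroidery.stitching {g} {p} {d} em) (FromEmbroidery.stitching-closed {g} {p} {d} em n>0 adj)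
  where
  n>0 : 0 < length (staircase g p d)
  n>0 = subst (0 <_) (sym (length-staircase g p d)) (ℕP.<-≤-trans g>0 (ℕP.m≤m+n g (p + d)))
  transport : ∀ {n n'} (e : n ≡ n') (S : Stitching n (depth g p)) → Closed S →
              Closed (subst (λ m → Stitching m (depth g p)) e S)
  transport refl _ c = c

true≢false : true ≡ false → ⊥
true≢false ()

false≢true : false ≡ true → ⊥
false≢true ()

-- Parity colouring of vertices: both ends of a diagonal have the same colour,
-- a unit step changes it.
even? : ℕ → Bool
even? zero    = true
even? (suc k) = not (even? k)

colour : Pt → Bool
colour (u , v) = even? (u + v)

colour-∼ : ∀ {A B} → A ∼ B → colour B ≡ not (colour A)
colour-∼ (east refl refl) = refl
colour-∼ {suc u' , v} (west refl refl) = sym (not-involutive (even? (u' + v)))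
colour-∼ {u , v} (south refl refl) = cong even? (ℕP.+-suc u v)
colour-∼ {u , suc v'} (north refl refl) =
  trans (sym (not-involutive _)) (cong not (sym (cong even? (ℕP.+-suc u v'))))

colour-ends : ∀ D κ → colour (proj₁ (ends D κ)) ≡ colour (proj₂ (ends D κ))
colour-ends D (m , lower) = cong even? (ℕP.+-assoc m 1 (D m))
colour-ends D (m , upper) = sym (trans (cong even? (arith m (D m))) (not-involutive _))
  where arith : ∀ m x → m + 1 + suc x ≡ suc (suc (m + x))
        arith = solve-∀

even?-double : ∀ n → even? (2 * n) ≡ true
even?-double zero    = refl
even?-double (suc n) =
  trans (cong even? (cong suc (ℕP.+-suc n (n + 0)))) (trans (not-involutive _) (even?-double n))

even?-pred : ∀ M → even? M ≡ true → 0 < M → even? (M ∸ 1) ≡ false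
even?-pred (suc M) e _ with even? M
... | false = refl
... | true  = ⊥-elim (false≢true e)

∼-column : ∀ {A B} → A ∼ B → proj₁ A ≤ suc (proj₁ B)
∼-column (east refl _)  = ℕP.≤-trans (ℕP.n≤1+n _) (ℕP.n≤1+n _)
∼-column (west refl _)  = ℕP.≤-refl
∼-column (south refl _) = ℕP.n≤1+n _
∼-column (north refl _) = ℕP.n≤1+n _

end-column≥ : ∀ D w m δ → IsEnd D w (m , δ) → m ≤ proj₁ w
end-column≥ D w m lower (inj₁ refl) = ℕP.m≤m+n m 1
end-column≥ D w m lower (inj₂ refl) = ℕP.≤-refl
end-column≥ D w m upper (inj₁ refl) = ℕP.≤-refl
end-column≥ D w m upper (inj₂ refl) = ℕP.m≤m+n m 1

end-column≤ : ∀ D w m δ → IsEnd D w (m , δ) → proj₁ w ≤ suc m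
end-column≤ D w m lower (inj₁ refl) = ℕP.≤-reflexive (ℕP.+-comm m 1)
end-column≤ D w m lower (inj₂ refl) = ℕP.n≤1+n m
end-column≤ D w m upper (inj₁ refl) = ℕP.n≤1+n m
end-column≤ D w m upper (inj₂ refl) = ℕP.≤-reflexive (ℕP.+-comm m 1)

end-row≥ : ∀ D w m δ → IsEnd D w (m , δ) → D m ≤ proj₂ w
end-row≥ D w m lower (inj₁ refl) = ℕP.≤-refl
end-row≥ D w m lower (inj₂ refl) = ℕP.n≤1+n _
end-row≥ D w m upper (inj₁ refl) = ℕP.≤-refl
end-row≥ D w m upper (inj₂ refl) = ℕP.n≤1+n _

end-row≤ : ∀ D w m δ → IsEnd D w (m , δ) → proj₂ w ≤ suc (D m)
end-row≤ D w m lower (inj₁ refl) = ℕP.n≤1+n _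
end-row≤ D w m lower (inj₂ refl) = ℕP.≤-refl
end-row≤ D w m upper (inj₁ refl) = ℕP.n≤1+n _
end-row≤ D w m upper (inj₂ refl) = ℕP.≤-refl

rising-edge : (P : ℕ → Bool) → ∀ j → P 0 ≡ false → P j ≡ true →
              ∃ λ k → suc k ≤ j × P k ≡ false × P (suc k) ≡ true
rising-edge P zero    f t = ⊥-elim (false≢true (trans (sym f) t))
rising-edge P (suc j) f t with P j in e
... | false = j , ℕP.≤-refl , e , t
... | true with rising-edge P j f e
...   | k , k<j , before , after = k , ℕP.m≤n⇒m≤1+n k<j , before , after

falling-edge : (P : ℕ → Bool) → ∀ j M → j ≤ M → P j ≡ true → P M ≡ false →
               ∃ λ k → j ≤ k × k < M × P k ≡ true × P (suc k) ≡ false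
falling-edge P j zero    z≤n t f = ⊥-elim (true≢false (trans (sym t) f))
falling-edge P j (suc M) j≤ t f with ℕP.m≤n⇒m<n∨m≡n j≤
... | inj₂ refl = ⊥-elim (true≢false (trans (sym t) f))
... | inj₁ j≤M with P M in e
...   | true  = M , ℕP.≤-pred j≤M , ℕP.n<1+n M , e , f
...   | false with falling-edge P j M (ℕP.≤-pred j≤M) t e
...     | k , j≤k , k<M , before , after = k , j≤k , ℕP.m≤n⇒m≤1+n k<M , before , after

record EndCell (n : ℕ) (D : ℕ → ℕ) (c₁ c₂ : ℕ) : Set where
  field
    J₀ J₁      : Pt
    c₁<n       : c₁ < n
    upper-ends : ends D (c₁ , upper) ≡ (J₀ , J₁) ⊎ ends D (c₁ , upper) ≡ (J₁ , J₀)
    near-J₀    : ∀ κ w → proj₁ κ < n → IsEnd D w κ → w ∼ J₀ → κ ∈ (c₁ , lower) ∷ []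
    near-J₁    : ∀ κ w → proj₁ κ < n → IsEnd D w κ → w ∼ J₁ → κ ∈ (c₁ , lower) ∷ (c₂ , lower) ∷ []
    near-lower : ∀ κ w z → proj₁ κ < n → IsEnd D w κ → IsEnd D z (c₁ , lower) → w ∼ z →
                 κ ∈ (c₁ , upper) ∷ (c₂ , upper) ∷ []

record CutVertex (n : ℕ) (D : ℕ → ℕ) (inA : ℕ → Bool) (K : Pt) (cA cB : ℕ) : Set where
  field
    cA<n        : cA < n
    cA∈A        : inA cA ≡ true
    crossing    : ∀ κ κ' v w → proj₁ κ < n → proj₁ κ' < n → inA (proj₁ κ) ≡ true → inA (proj₁ κ') ≡ false →
                  IsEnd D v κ → IsEnd D w κ' → v ∼ w → v ≡ K ⊎ w ≡ K
    K-in-A      : ∀ κ → proj₁ κ < n → inA (proj₁ κ) ≡ true → IsEnd D K κ → κ ∈ (cA , upper) ∷ []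
    K-in-B      : ∀ κ → proj₁ κ < n → inA (proj₁ κ) ≡ false → IsEnd D K κ → κ ∈ (cB , upper) ∷ []
    near-K-in-B : ∀ κ w → proj₁ κ < n → inA (proj₁ κ) ≡ false → IsEnd D w κ → w ∼ K → κ ∈ (cB , lower) ∷ []

module OnStitching {n : ℕ} {D : ℕ → ℕ} (S : Stitching n D) where
  open Stitching S

  N : ℕ
  N = 2 * n

  start-end : ∀ k → k < N → IsEnd D (start k) (key k)
  start-end k k< = start-isEnd (ends D (key k)) (front k k<)

  finish-end : ∀ k → k < N → IsEnd D (finish k) (key k)
  finish-end k k< = finish-isEnd (ends D (key k)) (front k k<)

  first< : 0 < n → 0 < N
  first< n>0 = ℕP.<-≤-trans n>0 (ℕP.m≤m+n n (n + 0))

  last< : 0 < n → N ∸ 1 < N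
  last< n>0 = ℕP.∸-monoʳ-< {o = 0} (s≤s z≤n) (first< n>0)

  last-or-next : ∀ k → k < N → k ≡ N ∸ 1 ⊎ suc k < N
  last-or-next k k< with suc k <? N
  ... | yes sk< = inj₂ sk<
  ... | no  sk≮ = inj₁ (cong (_∸ 1) (ℕP.≤-antisym k< (ℕP.≮⇒≥ sk≮)))

  once : ∀ {i j κ} → i < N → j < N → key i ≡ κ → key j ≡ κ → i < j → ⊥
  once i< j< ei ej i<j = ℕP.<-irrefl (key-injective _ _ i< j< (trans ei (sym ej))) i<j

  -- Parity: the thread alternates colours at every back stitch, so the last
  -- front stitch starts on the colour opposite to the first.
  colour-front : ∀ k → k < N → colour (start k) ≡ colour (finish k)
  colour-front k k< with front k k<
  ... | inj₁ (s , f) = trans (cong colour s) (trans (colour-ends D (key k)) (cong colour (sym f)))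
  ... | inj₂ (s , f) = trans (cong colour s) (trans (sym (colour-ends D (key k))) (cong colour (sym f)))

  colour-start : ∀ k → k < N → colour (start k) ≡ (if even? k then colour (start 0) else not (colour (start 0)))
  colour-start zero    _   = refl
  colour-start (suc k) sk< = begin
    colour (start (suc k))        ≡⟨ colour-∼ (back k sk<) ⟩
    not (colour (finish k))       ≡⟨ cong not (sym (colour-front k k<)) ⟩
    not (colour (start k))        ≡⟨ cong not (colour-start k k<) ⟩
    not (if even? k then c₀ else not c₀) ≡⟨ not-if (even? k) ⟩
    (if not (even? k) then c₀ else not c₀) ∎
    where
    open ≡-Reasoning
    c₀ = colour (start 0)
    k< = ℕP.<-trans (ℕP.n<1+n k) sk<
    not-if : ∀ e → not (if e then c₀ else not c₀) ≡ (if not e then c₀ else not c₀)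
    not-if true  = refl
    not-if false = not-involutive c₀

  thread-parity : 0 < n → colour (start (N ∸ 1)) ≡ not (colour (start 0))
  thread-parity n>0 =
    trans (colour-start (N ∸ 1) (last< n>0))
          (cong (λ e → if e then colour (start 0) else not (colour (start 0)))
                (even?-pred N (even?-double n) (first< n>0)))

  colour-start-key : ∀ k → k < N → colour (start k) ≡ colour (proj₁ (ends D (key k)))
  colour-start-key k k< with start-end k k<
  ... | inj₁ s = cong colour s
  ... | inj₂ s = trans (cong colour s) (sym (colour-ends D (key k)))

  module _ {c₁ c₂ : ℕ} (E : EndCell n D c₁ c₂) where
    open EndCell E

    private
      L = key-surjective c₁ lower c₁<n
      l = proj₁ L
      l< = proj₁ (proj₂ L)
      keyl = proj₂ (proj₂ L)

      lowerBefore : ∀ {k} → k < N → key k ≡ (c₁ , upper) → l < k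
      lowerBefore k< ek = lowerFirst l _ c₁ l< k< keyl ek

      -- Sewn towards J₀, the upper diagonal cannot be followed: the next
      -- stitch would be the lower diagonal again.
      towardsJ₀ : ∀ k → k < N → key k ≡ (c₁ , upper) → finish k ≡ J₀ → key (N ∸ 1) ≡ (c₁ , upper)
      towardsJ₀ k k< ek f with last-or-next k k<
      ... | inj₁ k≡last = subst (λ j → key j ≡ (c₁ , upper)) k≡last ek
      ... | inj₂ sk< with near-J₀ (key (suc k)) (start (suc k)) (key-cell _ sk<) (start-end _ sk<)
                            (∼-sym (subst (_∼ start (suc k)) f (back k sk<)))
      ...   | here e = ⊥-elim (once l< sk< keyl e (ℕP.<-trans (lowerBefore k< ek) (ℕP.n<1+n k)))

      lowerJustBefore : ∀ k → suc k < N → key (suc k) ≡ (c₁ , upper) → start (suc k) ≡ J₀ → key k ≡ (c₁ , lower)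
      lowerJustBefore k sk< ek s
        with near-J₀ (key k) (finish k) (key-cell _ k<) (finish-end _ k<) (subst (finish k ∼_) s (back k sk<))
        where k< = ℕP.<-trans (ℕP.n<1+n k) sk<
      ... | here e = e

      -- Otherwise the stitch before the lower diagonal is c₂'s upper diagonal,
      -- and nothing can follow the upper diagonal of c₁.
      awayFromJ₀ : ∀ k → k < N → key k ≡ (c₁ , upper) → start k ≡ J₀ → finish k ≡ J₁ →
                   key 0 ≡ (c₁ , lower) ⊎ key (N ∸ 1) ≡ (c₁ , upper)
      awayFromJ₀ zero k< ek _ _ = ⊥-elim (ℕP.n≮0 (lowerBefore k< ek))
      awayFromJ₀ (suc zero) k< ek s _ = inj₁ (lowerJustBefore 0 k< ek s)
      awayFromJ₀ (suc (suc k)) k+2< ek s f = inj₂ lastStitch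
        where
        k+1< = ℕP.<-trans (ℕP.n<1+n (suc k)) k+2<
        k<   = ℕP.<-trans (ℕP.n<1+n k) k+1<
        lower-k+1 = lowerJustBefore (suc k) k+2< ek s
        upper-k : key k ≡ (c₂ , upper)
        upper-k with near-lower (key k) (finish k) (start (suc k)) (key-cell _ k<) (finish-end _ k<)
                       (subst (IsEnd D (start (suc k))) lower-k+1 (start-end _ k+1<)) (back k k+1<)
        ... | here e = ⊥-elim (once k< k+2< e ek (ℕP.<-trans (ℕP.n<1+n k) (ℕP.n<1+n (suc k))))
        ... | there (here e) = e
        lastStitch : key (N ∸ 1) ≡ (c₁ , upper)
        lastStitch with last-or-next _ k+2<
        ... | inj₁ last = subst (λ j → key j ≡ (c₁ , upper)) last ek
        ... | inj₂ k+3< with near-J₁ (key (3 + k)) (start (3 + k)) (key-cell _ k+3<) (start-end _ k+3<)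
                               (∼-sym (subst (_∼ start (3 + k)) f (back _ k+3<)))
        ...   | here e = ⊥-elim (once k+1< k+3< lower-k+1 e (ℕP.<-trans (ℕP.n<1+n (suc k)) (ℕP.n<1+n (2 + k))))
        ...   | there (here e) = ⊥-elim (ℕP.<-asym (lowerFirst _ k c₂ k+3< k< e upper-k)
                                     (ℕP.<-trans (ℕP.n<1+n k) (ℕP.<-trans (ℕP.n<1+n (suc k)) (ℕP.n<1+n (2 + k)))))

      0<N = first< (ℕP.≤-<-trans z≤n c₁<n)
      last<N = last< (ℕP.≤-<-trans z≤n c₁<n)

      U = key-surjective c₁ upper c₁<n
      u = proj₁ U
      u< = proj₁ (proj₂ U)
      keyu = proj₂ (proj₂ U)

    endCell : key 0 ≡ (c₁ , lower) ⊎ key (N ∸ 1) ≡ (c₁ , upper)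
    endCell with orient (subst (λ κ → Traverses (start u) (finish u) (ends D κ)) keyu (front u u<)) upper-ends
    ... | inj₁ (s , f) = awayFromJ₀ u u< keyu s f
    ... | inj₂ (_ , f) = inj₂ (towardsJ₀ u u< keyu f)

    endCell-closed : Closed S → proj₁ (key 0) ∈ c₁ ∷ c₂ ∷ [] × proj₁ (key (N ∸ 1)) ∈ c₁ ∷ c₂ ∷ []
    endCell-closed closed with endCell
    ... | inj₁ first = here (cong proj₁ first) ,
          cellOf (near-lower (key (N ∸ 1)) (finish (N ∸ 1)) (start 0) (key-cell _ last<N) (finish-end _ last<N)
                             (subst (IsEnd D (start 0)) first (start-end 0 0<N)) closed)
      where
      cellOf : ∀ {κ} → κ ∈ (c₁ , upper) ∷ (c₂ , upper) ∷ [] → proj₁ κ ∈ c₁ ∷ c₂ ∷ []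
      cellOf (here refl) = here refl
      cellOf (there (here refl)) = there (here refl)
    ... | inj₂ last = firstCell , here (cong proj₁ last)
      where
      firstCell : proj₁ (key 0) ∈ c₁ ∷ c₂ ∷ []
      firstCell with orient (subst (λ κ → Traverses (start (N ∸ 1)) (finish (N ∸ 1)) (ends D κ)) last
                                   (front (N ∸ 1) last<N)) upper-ends
      ... | inj₁ (_ , f) with near-J₁ (key 0) (start 0) (key-cell 0 0<N) (start-end 0 0<N)
                                  (∼-sym (subst (_∼ start 0) f closed))
      ...   | here e = here (cong proj₁ e)
      ...   | there (here e) = there (here (cong proj₁ e))
      firstCell | inj₂ (_ , f) with near-J₀ (key 0) (start 0) (key-cell 0 0<N) (start-end 0 0<N)
                                       (∼-sym (subst (_∼ start 0) f closed))
      ...   | here e = here (cong proj₁ e)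

  module _ {inA : ℕ → Bool} {K : Pt} {cA cB : ℕ} (C : CutVertex n D inA K cA cB) where
    open CutVertex C

    private
      inside : ℕ → Bool
      inside k = inA (proj₁ (key k))

      L = key-surjective cA lower cA<n
      l = proj₁ L
      l< = proj₁ (proj₂ L)
      keyl = proj₂ (proj₂ L)

      -- Entering A before cA's lower diagonal is sewn, the thread crosses at
      -- K, coming from cB's upper diagonal (cA's upper one is not yet allowed).
      entry : ∀ k → suc k ≤ l → inside k ≡ false → inside (suc k) ≡ true → key k ≡ (cB , upper)
      entry k k+1≤l k∉A k+1∈A =
        through (crossing (key (suc k)) (key k) (start (suc k)) (finish k) (key-cell _ k+1<) (key-cell _ k<)
                          k+1∈A k∉A (start-end _ k+1<) (finish-end _ k<) (∼-sym (back k k+1<)))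
        where
        k+1< = ℕP.≤-<-trans k+1≤l l<
        k<   = ℕP.<-trans (ℕP.n<1+n k) k+1<
        through : start (suc k) ≡ K ⊎ finish k ≡ K → key k ≡ (cB , upper)
        through (inj₁ s≡K) with K-in-A (key (suc k)) (key-cell _ k+1<) k+1∈A
                                       (subst (λ w → IsEnd D w (key (suc k))) s≡K (start-end _ k+1<))
        ... | here e = ⊥-elim (ℕP.<⇒≱ (lowerFirst l (suc k) cA l< k+1< keyl e) k+1≤l)
        through (inj₂ f≡K) with K-in-B (key k) (key-cell _ k<) k∉A (subst (λ w → IsEnd D w (key k)) f≡K (finish-end _ k<))
        ... | here e = e

      exit : ∀ k → suc k < N → inside k ≡ true → inside (suc k) ≡ false →
             key (suc k) ≡ (cB , lower) ⊎ key (suc k) ≡ (cB , upper)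
      exit k k+1< k∈A k+1∉A =
        through (crossing (key k) (key (suc k)) (finish k) (start (suc k)) (key-cell _ k<) (key-cell _ k+1<)
                          k∈A k+1∉A (finish-end _ k<) (start-end _ k+1<) (back k k+1<))
        where
        k< = ℕP.<-trans (ℕP.n<1+n k) k+1<
        through : finish k ≡ K ⊎ start (suc k) ≡ K → key (suc k) ≡ (cB , lower) ⊎ key (suc k) ≡ (cB , upper)
        through (inj₁ f≡K) with near-K-in-B (key (suc k)) (start (suc k)) (key-cell _ k+1<) k+1∉A (start-end _ k+1<)
                                            (∼-sym (subst (_∼ start (suc k)) f≡K (back k k+1<)))
        ... | here e = inj₁ e
        through (inj₂ s≡K) with K-in-B (key (suc k)) (key-cell _ k+1<) k+1∉A
                                       (subst (λ w → IsEnd D w (key (suc k))) s≡K (start-end _ k+1<))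
        ... | here e = inj₂ e

    -- The thread enters A before cA's lower diagonal and leaves A after it,
    -- so cB's upper diagonal would be followed by cB's lower one or repeated.
    cutVertex : inside 0 ≡ false → inside (N ∸ 1) ≡ false → ⊥
    cutVertex outside₀ outsideₗ =
      conclude (rising-edge inside l outside₀ inside-l) (falling-edge inside l (N ∸ 1) l≤last inside-l outsideₗ)
      where
      inside-l : inside l ≡ true
      inside-l = trans (cong (λ κ → inA (proj₁ κ)) keyl) cA∈A
      l≤last : l ≤ N ∸ 1
      l≤last = ℕP.≤-pred (subst (suc l ≤_) (sym (ℕP.suc-pred N {{ℕ.>-nonZero (ℕP.≤-<-trans z≤n l<)}})) l<)
      conclude : (∃ λ k → suc k ≤ l × inside k ≡ false × inside (suc k) ≡ true) →
                 (∃ λ k' → l ≤ k' × k' < N ∸ 1 × inside k' ≡ true × inside (suc k') ≡ false) → ⊥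
      conclude (k , k+1≤l , k∉A , k+1∈A) (k' , l≤k' , k'<last , k'∈A , k'+1∉A) = afterExit (exit k' k'+1< k'∈A k'+1∉A)
        where
        k'+1< = ℕP.≤-<-trans k'<last (last< (ℕP.≤-<-trans z≤n cA<n))
        k<    = ℕP.<-trans (ℕP.n<1+n k) (ℕP.≤-<-trans k+1≤l l<)
        k<k'+1 : k < suc k'
        k<k'+1 = s≤s (ℕP.≤-trans (ℕP.≤-trans (ℕP.n≤1+n k) k+1≤l) l≤k')
        entered = entry k k+1≤l k∉A k+1∈A
        afterExit : key (suc k') ≡ (cB , lower) ⊎ key (suc k') ≡ (cB , upper) → ⊥
        afterExit (inj₁ e) = ℕP.<-asym (lowerFirst (suc k') k cB k'+1< k< e entered) k<k'+1
        afterExit (inj₂ e) = once k< k'+1< entered e k<k'+1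

-- When the cells B + t (t < T) of a configuration at depths D lie at
-- depths V + s t, their diagonals are those of a small model configuration of
-- depths s translated by (B , V).  Facts about the diagonals near a vertex can
-- then be checked on the model, where they are finite and decided by
-- computation.
shift : ℕ → ℕ → Pt → Pt
shift B V (u , v) = (B + u , V + v)

shiftKey : ℕ → Key → Key
shiftKey B (t , δ) = (B + t , δ)

Window : (D s : ℕ → ℕ) (B V T : ℕ) → Set
Window D s B V T = ∀ t → t < T → D (B + t) ≡ V + s t

shift-injective : ∀ {B V} A A' → shift B V A ≡ shift B V A' → A ≡ A'
shift-injective {B} {V} _ _ e = cong₂ _,_ (ℕP.+-cancelˡ-≡ B _ _ (cong proj₁ e)) (ℕP.+-cancelˡ-≡ V _ _ (cong proj₂ e))

∼-unshift : ∀ {B V} A A' → shift B V A ∼ shift B V A' → A ∼ A'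
∼-unshift {B} {V} (u , v) (u' , v') (east e f)  = east (ℕP.+-cancelˡ-≡ B _ _ (trans e (sym (ℕP.+-suc B u)))) (ℕP.+-cancelˡ-≡ V _ _ f)
∼-unshift {B} {V} (u , v) (u' , v') (west e f)  = west (ℕP.+-cancelˡ-≡ B _ _ (trans e (sym (ℕP.+-suc B u')))) (ℕP.+-cancelˡ-≡ V _ _ f)
∼-unshift {B} {V} (u , v) (u' , v') (south e f) = south (ℕP.+-cancelˡ-≡ B _ _ e) (ℕP.+-cancelˡ-≡ V _ _ (trans f (sym (ℕP.+-suc V v))))
∼-unshift {B} {V} (u , v) (u' , v') (north e f) = north (ℕP.+-cancelˡ-≡ B _ _ e) (ℕP.+-cancelˡ-≡ V _ _ (trans f (sym (ℕP.+-suc V v'))))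

ends-shift : ∀ {D s B V T} → Window D s B V T → ∀ t δ → t < T →
             ends D (B + t , δ) ≡ (shift B V (proj₁ (ends s (t , δ))) , shift B V (proj₂ (ends s (t , δ))))
ends-shift {B = B} {V} win t lower t< =
  cong₂ _,_ (cong₂ _,_ (ℕP.+-assoc B t 1) (win t t<)) (cong (B + t ,_) (trans (cong suc (win t t<)) (sym (ℕP.+-suc V _))))
ends-shift {B = B} {V} win t upper t< =
  cong₂ _,_ (cong (B + t ,_) (win t t<)) (cong₂ _,_ (ℕP.+-assoc B t 1) (trans (cong suc (win t t<)) (sym (ℕP.+-suc V _))))

LocalFact : (s : ℕ → ℕ) (tmin T : ℕ) (W : Pt → Set) (ks : List Key) → Set
LocalFact s tmin T W ks = ∀ t δ w → tmin ≤ t → t < T → IsEnd s w (t , δ) → W w → (t , δ) ∈ ks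

_∼?_ : ∀ A B → Dec (A ∼ B)
(u , v) ∼? (u' , v') =
  ((u' ≟ suc u) ×-dec (v ≟ v')) ⊎-dec ((u ≟ suc u') ×-dec (v ≟ v')) ⊎-dec
  ((u ≟ u') ×-dec (v' ≟ suc v)) ⊎-dec ((u ≟ u') ×-dec (v ≟ suc v'))

_≟Pt_ : DecidableEquality Pt
_≟Pt_ = ×-≡-dec _≟_ _≟_

_≟Key_ : DecidableEquality Key
_≟Key_ = ×-≡-dec _≟_ diag-dec
  where
  diag-dec : DecidableEquality Diag
  diag-dec lower lower = yes refl
  diag-dec lower upper = no λ ()
  diag-dec upper lower = no λ ()
  diag-dec upper upper = yes refl

open import Data.List.Membership.DecPropositional _≟Key_ using (_∈?_)

module _ (s : ℕ → ℕ) (tmin T : ℕ) {W : Pt → Set} (W? : ∀ w → Dec (W w)) (ks : List Key) where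
  private
    Cond : Key → Set
    Cond κ = tmin ≤ proj₁ κ → (W (proj₁ (ends s κ)) → κ ∈ ks) × (W (proj₂ (ends s κ)) → κ ∈ ks)

    cond? : ∀ κ → Dec (Cond κ)
    cond? κ = (tmin ℕ.≤? proj₁ κ) →-dec ((W? _ →-dec (κ ∈? ks)) ×-dec (W? _ →-dec (κ ∈? ks)))

    column? : ∀ t → Dec (Cond (t , lower) × Cond (t , upper))
    column? t = cond? (t , lower) ×-dec cond? (t , upper)

  byComputation : {_ : True (ℕP.allUpTo? column? T)} → LocalFact s tmin T W ks
  byComputation {ok} t δ w tmin≤t t<T end Ww = fromColumn δ (toWitness ok t<T) end
    where
    fromColumn : ∀ δ → Cond (t , lower) × Cond (t , upper) → IsEnd s w (t , δ) → (t , δ) ∈ ks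
    fromColumn lower (c , _) (inj₁ refl) = proj₁ (c tmin≤t) Ww
    fromColumn lower (c , _) (inj₂ refl) = proj₂ (c tmin≤t) Ww
    fromColumn upper (_ , c) (inj₁ refl) = proj₁ (c tmin≤t) Ww
    fromColumn upper (_ , c) (inj₂ refl) = proj₂ (c tmin≤t) Ww

fromWindow : ∀ {D s B V T tmin W ks} → Window D s B V T → LocalFact s tmin T W ks →
             ∀ (W' : Pt → Set) → (∀ w → W' (shift B V w) → W w) →
             ∀ m δ w → B + tmin ≤ m → m < B + T → IsEnd D w (m , δ) → W' w → (m , δ) ∈ map (shiftKey B) ks
fromWindow {D} {s} {B} {V} {T} {tmin} {W} {ks} win fact W' unshift m δ w lo hi end W'w =
  subst (λ m → (m , δ) ∈ map (shiftKey B) ks) m≡ (∈-map⁺ (shiftKey B) (model end′ W'w))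
  where
  B≤m = ℕP.≤-trans (ℕP.m≤m+n B tmin) lo
  t = m ∸ B
  m≡ : B + t ≡ m
  m≡ = ℕP.m+[n∸m]≡n B≤m
  tmin≤t : tmin ≤ t
  tmin≤t = ℕP.+-cancelˡ-≤ B _ _ (subst (B + tmin ≤_) (sym m≡) lo)
  t<T : t < T
  t<T = ℕP.+-cancelˡ-< B _ _ (subst (_< B + T) (sym m≡) hi)
  end′ : IsEnd D w (B + t , δ)
  end′ = subst (λ m → IsEnd D w (m , δ)) (sym m≡) end
  model : IsEnd D w (B + t , δ) → W' w → (t , δ) ∈ _
  model (inj₁ e) W'w = fact t δ _ tmin≤t t<T (inj₁ refl)
    (unshift _ (subst W' (trans e (cong proj₁ (ends-shift win t δ t<T))) W'w))
  model (inj₂ e) W'w = fact t δ _ tmin≤t t<T (inj₂ refl)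
    (unshift _ (subst W' (trans e (cong proj₂ (ends-shift win t δ t<T))) W'w))

module _ {D s : ℕ → ℕ} {B V T : ℕ} (win : Window D s B V T) where
  nearVertex : ∀ {tmin ks} J → LocalFact s tmin T (_∼ J) ks →
               ∀ m δ w → B + tmin ≤ m → m < B + T → IsEnd D w (m , δ) → w ∼ shift B V J →
               (m , δ) ∈ map (shiftKey B) ks
  nearVertex J fact = fromWindow win fact (_∼ shift B V J) (λ w a → ∼-unshift w J a)

  atVertex : ∀ {tmin ks} K → LocalFact s tmin T (_≡ K) ks →
             ∀ m δ → B + tmin ≤ m → m < B + T → IsEnd D (shift B V K) (m , δ) →
             (m , δ) ∈ map (shiftKey B) ks
  atVertex K fact m δ lo hi end =
    fromWindow win fact (_≡ shift B V K) (λ w e → shift-injective w K e) m δ (shift B V K) lo hi end refl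

  nearDiagonal : ∀ {tmin ks} t₀ δ₀ → t₀ < T →
                 LocalFact s tmin T (λ w → w ∼ proj₁ (ends s (t₀ , δ₀)) ⊎ w ∼ proj₂ (ends s (t₀ , δ₀))) ks →
                 ∀ m δ w z → B + tmin ≤ m → m < B + T → IsEnd D w (m , δ) → IsEnd D z (B + t₀ , δ₀) → w ∼ z →
                 (m , δ) ∈ map (shiftKey B) ks
  nearDiagonal t₀ δ₀ t₀< fact m δ w z lo hi end endz a =
    fromWindow win fact (λ w → Σ Pt λ z → IsEnd D z (B + t₀ , δ₀) × w ∼ z) unshift m δ w lo hi end (z , endz , a)
    where
    unshift : ∀ w → (Σ Pt λ z → IsEnd D z (B + t₀ , δ₀) × shift B V w ∼ z) →
              w ∼ proj₁ (ends s (t₀ , δ₀)) ⊎ w ∼ proj₂ (ends s (t₀ , δ₀))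
    unshift w (z , inj₁ e , a) = inj₁ (∼-unshift w _ (subst (shift B V w ∼_) (trans e (cong proj₁ (ends-shift win t₀ δ₀ t₀<))) a))
    unshift w (z , inj₂ e , a) = inj₂ (∼-unshift w _ (subst (shift B V w ∼_) (trans e (cong proj₂ (ends-shift win t₀ δ₀ t₀<))) a))

near-cell≤ : ∀ D w m δ {J} → IsEnd D w (m , δ) → w ∼ J → m ≤ suc (proj₁ J)
near-cell≤ D w m δ end a = ℕP.≤-trans (end-column≥ D w m δ end) (∼-column a)

near-cell≥ : ∀ D w m δ {J} → IsEnd D w (m , δ) → w ∼ J → proj₁ J ≤ suc (suc m)
near-cell≥ D w m δ end a = ℕP.≤-trans (∼-column (∼-sym a)) (s≤s (end-column≤ D w m δ end))

corner : ∀ X Y (v w : Pt) → proj₁ v ≤ X → proj₂ v ≤ Y → X ≤ proj₁ w → Y ≤ proj₂ w → v ∼ w →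
         v ≡ (X , Y) ⊎ w ≡ (X , Y)
corner X Y (u , v) (_ , _) u≤ v≤ ≤u' ≤v' (east refl refl) with ℕP.≤-antisym v≤ ≤v'
... | refl with ℕP.m≤n⇒m<n∨m≡n u≤
...   | inj₁ u<X = inj₂ (cong (_, v) (ℕP.≤-antisym u<X ≤u'))
...   | inj₂ refl = inj₁ refl
corner X Y (_ , _) (u' , _) u≤ _ ≤u' _ (west refl refl) = ⊥-elim (ℕP.<-irrefl refl (ℕP.≤-trans u≤ ≤u'))
corner X Y (u , v) (_ , _) u≤ v≤ ≤u' ≤v' (south refl refl) with ℕP.≤-antisym u≤ ≤u'
... | refl with ℕP.m≤n⇒m<n∨m≡n v≤
...   | inj₁ v<Y = inj₂ (cong (u ,_) (ℕP.≤-antisym v<Y ≤v'))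
...   | inj₂ refl = inj₁ refl
corner X Y (_ , _) (_ , v') _ v≤ _ ≤v' (north refl refl) = ⊥-elim (ℕP.<-irrefl refl (ℕP.≤-trans v≤ ≤v'))

module FirstCell (g₂ p₁ d : ℕ) where
  private
    g = 2 + g₂
    p = suc p₁

  window : Window (depth g p) (λ t → t) 0 0 3
  window t t<3 with t <? g
  ... | yes t<g = depth-G g p t t<g
  ... | no  t≮g = trans (depth-P g p t g≤t (ℕP.<-≤-trans t<g+1 (ℕP.+-monoʳ-≤ g (s≤s z≤n)))) (sym t≡g)
    where
    g≤t = ℕP.≮⇒≥ t≮g
    t≡g : t ≡ g
    t≡g = ℕP.≤-antisym (ℕP.≤-trans (ℕP.≤-pred t<3) (s≤s (s≤s z≤n))) g≤t
    t<g+1 : t < g + 1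
    t<g+1 = subst (t <_) (ℕP.+-comm 1 g) (s≤s (ℕP.≤-reflexive t≡g))

  endCell : EndCell (g + (p + d)) (depth g p) 0 1
  endCell = record
    { J₀ = (0 , 0)
    ; J₁ = (1 , 1)
    ; c₁<n = s≤s z≤n
    ; upper-ends = inj₁ (cong (λ z → ((0 , z) , (1 , suc z))) (window 0 (s≤s z≤n)))
    ; near-J₀ = λ { (m , δ) w _ end a → nearVertex window (0 , 0)
                     (byComputation (λ t → t) 0 3 (_∼? (0 , 0)) ((0 , lower) ∷ []))
                     m δ w z≤n (s≤s (ℕP.≤-trans (near-cell≤ _ w m δ end a) (s≤s z≤n))) end a }
    ; near-J₁ = λ { (m , δ) w _ end a → nearVertex window (1 , 1)
                     (byComputation (λ t → t) 0 3 (_∼? (1 , 1)) ((0 , lower) ∷ (1 , lower) ∷ []))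
                     m δ w z≤n (s≤s (near-cell≤ _ w m δ end a)) end a }
    ; near-lower = λ { (m , δ) w z _ end endz a → nearDiagonal window 0 lower (s≤s z≤n)
                     (byComputation (λ t → t) 0 3 (λ w → (w ∼? (1 , 0)) ⊎-dec (w ∼? (0 , 1))) ((0 , upper) ∷ (1 , upper) ∷ []))
                     m δ w z z≤n (s≤s (ℕP.≤-trans (near-cell≤ _ w m δ end a) (s≤s (end-column≤ (depth g p) z 0 lower endz)))) end endz a }
    }

depth-tail : ∀ g₁ p₁ k → depth (suc g₁) (suc p₁) (g₁ + suc p₁ + k) ≡ g₁ + suc k
depth-tail g₁ p₁ zero = begin
  depth g p (g₁ + p + 0) ≡⟨ cong (depth g p) (trans (ℕP.+-identityʳ (g₁ + p)) (ℕP.+-suc g₁ p₁)) ⟩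
  depth g p (g + p₁)     ≡⟨ depth-landing g p p₁ (ℕP.n<1+n p₁) ⟩
  g                      ≡⟨ ℕP.+-comm 1 g₁ ⟩
  g₁ + 1 ∎
  where
  open ≡-Reasoning
  g = suc g₁
  p = suc p₁
depth-tail g₁ p₁ (suc k) = begin
  depth g p (g₁ + p + suc k) ≡⟨ cong (depth g p) (arith g₁ p₁ k) ⟩
  depth g p (g + p + k)      ≡⟨ depth-second g p k ⟩
  suc g + k                  ≡⟨ arith′ g₁ k ⟩
  g₁ + suc (suc k) ∎
  where
  open ≡-Reasoning
  g = suc g₁
  p = suc p₁
  arith : ∀ g₁ p₁ k → g₁ + suc p₁ + suc k ≡ suc g₁ + suc p₁ + k
  arith = solve-∀
  arith′ : ∀ g₁ k → suc (suc g₁) + k ≡ g₁ + suc (suc k)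
  arith′ = solve-∀

<ᵇ-true : ∀ {m k} → m < k → (m <ᵇ k) ≡ true
<ᵇ-true {m} {k} m<k with m <ᵇ k | ℕP.<⇒<ᵇ m<k
... | true | _ = refl

<ᵇ-false : ∀ {m k} → k ≤ m → (m <ᵇ k) ≡ false
<ᵇ-false {m} {k} k≤m with m <ᵇ k | ℕP.<ᵇ⇒< m k
... | false | _   = refl
... | true  | m<k = ⊥-elim (ℕP.<⇒≱ (m<k tt) k≤m)

<ᵇ-true⁻¹ : ∀ {m k} → (m <ᵇ k) ≡ true → m < k
<ᵇ-true⁻¹ {m} {k} e = ℕP.<ᵇ⇒< m k (subst T (sym e) tt)

<ᵇ-false⁻¹ : ∀ {m k} → (m <ᵇ k) ≡ false → k ≤ m
<ᵇ-false⁻¹ e = ℕP.≮⇒≥ λ m<k → true≢false (trans (sym (<ᵇ-true m<k)) e)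

module LastCell (g₁ p₁ d₂ : ℕ) where
  private
    g = suc g₁
    p = suc p₁
    d = 2 + d₂
  B V : ℕ
  B = g₁ + p + d₂
  V = g₁ + d₂

  n≡ : g + (p + d) ≡ B + 3
  n≡ = arith g₁ p d₂
    where arith : ∀ g₁ p d₂ → suc g₁ + (p + suc (suc d₂)) ≡ g₁ + p + d₂ + 3
          arith = solve-∀

  window : Window (depth g p) suc B V 3
  window t _ = begin
    depth g p (g₁ + p + d₂ + t)   ≡⟨ cong (depth g p) (ℕP.+-assoc (g₁ + p) d₂ t) ⟩
    depth g p (g₁ + p + (d₂ + t)) ≡⟨ depth-tail g₁ p₁ (d₂ + t) ⟩
    g₁ + suc (d₂ + t)             ≡⟨ cong (λ z → g₁ + z) (sym (ℕP.+-suc d₂ t)) ⟩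
    g₁ + (d₂ + suc t)             ≡⟨ sym (ℕP.+-assoc g₁ d₂ (suc t)) ⟩
    V + suc t ∎
    where open ≡-Reasoning

  private
    at-least-B : ∀ m → B + 2 ≤ suc (suc m) → B + 0 ≤ m
    at-least-B m le = subst (_≤ m) (sym (ℕP.+-identityʳ B)) (ℕP.≤-pred (ℕP.≤-pred (subst (_≤ suc (suc m)) (ℕP.+-comm B 2) le)))

    below-n : ∀ {m} → m < g + (p + d) → m < B + 3
    below-n {m} = subst (m <_) n≡

  endCell : EndCell (g + (p + d)) (depth g p) (B + 2) (B + 1)
  endCell = record
    { J₀ = shift B V (3 , 4)
    ; J₁ = shift B V (2 , 3)
    ; c₁<n = subst (B + 2 <_) (sym n≡) (ℕP.+-monoʳ-< B (ℕP.n<1+n 2))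
    ; upper-ends = inj₂ (cong₂ (λ top bottom → ((B + 2 , top) , bottom)) (window 2 (ℕP.n<1+n 2))
                           (cong₂ _,_ (ℕP.+-assoc B 2 1) (trans (cong suc (window 2 (ℕP.n<1+n 2))) (sym (ℕP.+-suc V 3)))))
    ; near-J₀ = λ { (m , δ) w m< end a → nearVertex window (3 , 4)
                     (byComputation suc 0 3 (_∼? (3 , 4)) ((2 , lower) ∷ []))
                     m δ w (at-least-B m (ℕP.≤-trans (ℕP.+-monoʳ-≤ B (ℕP.n≤1+n 2)) (near-cell≥ _ w m δ end a)))
                     (below-n m<) end a }
    ; near-J₁ = λ { (m , δ) w m< end a → nearVertex window (2 , 3)
                     (byComputation suc 0 3 (_∼? (2 , 3)) ((2 , lower) ∷ (1 , lower) ∷ []))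
                     m δ w (at-least-B m (near-cell≥ _ w m δ end a)) (below-n m<) end a }
    ; near-lower = λ { (m , δ) w z m< end endz a → nearDiagonal window 2 lower (ℕP.n<1+n 2)
                     (byComputation suc 0 3 (λ w → (w ∼? (3 , 3)) ⊎-dec (w ∼? (2 , 4))) ((2 , upper) ∷ (1 , upper) ∷ []))
                     m δ w z (at-least-B m (ℕP.≤-trans (end-column≥ (depth g p) z (B + 2) lower endz) (near-cell≥ _ w m δ end a)))
                     (below-n m<) end endz a }
    }

-- The corner (g , g) where the landing touches the first staircase (g ≥ 2) is a
-- cut vertex; A consists of the cells from the landing on.
module FirstCut (g₂ p₁ d : ℕ) where
  private
    g = 2 + g₂
    p = suc p₁
    n = g + (p + d)
    g≡ : g ≡ g₂ + 2
    g≡ = ℕP.+-comm 2 g₂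

  inA : ℕ → Bool
  inA m = not (m <ᵇ g)

  window : Window (depth g p) (λ t → t) g₂ g₂ 3
  window t t<3 with g₂ + t <? g
  ... | yes lt = depth-G g p (g₂ + t) lt
  ... | no  ≮g = trans (cong (depth g p) cell≡) (trans (depth-landing g p 0 (s≤s z≤n)) (trans g≡ (sym cell≡′)))
    where
    t≡2 : t ≡ 2
    t≡2 = ℕP.≤-antisym (ℕP.≤-pred t<3) (ℕP.+-cancelˡ-≤ g₂ 2 t (subst (_≤ g₂ + t) g≡ (ℕP.≮⇒≥ ≮g)))
    cell≡ : g₂ + t ≡ g + 0
    cell≡ = trans (cong (λ z → g₂ + z) t≡2) (trans (sym g≡) (sym (ℕP.+-identityʳ g)))
    cell≡′ : g₂ + t ≡ g₂ + 2
    cell≡′ = cong (λ z → g₂ + z) t≡2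

  window₂ : Window (depth g p) (λ t → t) g₂ g₂ 2
  window₂ t t<2 = window t (ℕP.<-trans t<2 (ℕP.n<1+n 2))

  outside : ∀ {m} → inA m ≡ false → m < g
  outside {m} e = <ᵇ-true⁻¹ (trans (sym (not-involutive (m <ᵇ g))) (cong not e))

  inside : ∀ {m} → inA m ≡ true → g ≤ m
  inside {m} e = <ᵇ-false⁻¹ (trans (sym (not-involutive (m <ᵇ g))) (cong not e))

  cutVertex : CutVertex n (depth g p) inA (shift g₂ g₂ (2 , 2)) (g₂ + 2) (g₂ + 1)
  cutVertex = record
    { cA<n = subst (_< n) g≡ (ℕP.m<m+n g (s≤s z≤n))
    ; cA∈A = cong not (<ᵇ-false (ℕP.≤-reflexive g≡))
    ; crossing = λ { (m , δ) (m' , δ') v w _ _ inA-m inA-m' endv endw a → swap (corner (g₂ + 2) (g₂ + 2) w v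
        (subst (proj₁ w ≤_) g≡ (ℕP.≤-trans (end-column≤ (depth g p) w m' δ' endw) (outside inA-m')))
        (subst (proj₂ w ≤_) g≡ (ℕP.≤-trans (end-row≤ (depth g p) w m' δ' endw)
                                  (subst (λ z → suc z ≤ g) (sym (depth-G g p m' (outside inA-m'))) (outside inA-m'))))
        (subst (_≤ proj₁ v) g≡ (ℕP.≤-trans (inside inA-m) (end-column≥ (depth g p) v m δ endv)))
        (subst (_≤ proj₂ v) g≡ (ℕP.≤-trans (depth≥g g p m (inside inA-m)) (end-row≥ (depth g p) v m δ endv)))
        (∼-sym a)) }
    ; K-in-A = λ { (m , δ) _ inA-m end → atVertex window (2 , 2)
                    (byComputation (λ t → t) 2 3 (_≟Pt (2 , 2)) ((2 , upper) ∷ []))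
                    m δ (subst (_≤ m) g≡ (inside inA-m))
                    (subst (m <_) (sym (ℕP.+-suc g₂ 2)) (s≤s (end-column≥ (depth g p) _ m δ end))) end }
    ; K-in-B = λ { (m , δ) _ inA-m end → atVertex window₂ (2 , 2)
                    (byComputation (λ t → t) 1 2 (_≟Pt (2 , 2)) ((1 , upper) ∷ []))
                    m δ (ℕP.≤-pred (subst (_≤ suc m) (ℕP.+-suc g₂ 1) (end-column≤ (depth g p) _ m δ end)))
                    (subst (m <_) g≡ (outside inA-m)) end }
    ; near-K-in-B = λ { (m , δ) w _ inA-m end a → nearVertex window₂ (2 , 2)
                    (byComputation (λ t → t) 0 2 (_∼? (2 , 2)) ((1 , lower) ∷ []))
                    m δ w (subst (_≤ m) (sym (ℕP.+-identityʳ g₂)) (ℕP.+-cancelʳ-≤ 2 g₂ m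
                             (subst₂ _≤_ refl (ℕP.+-comm 2 m) (near-cell≥ _ w m δ end a))))
                    (subst (m <_) g≡ (outside inA-m)) end a }
    }
    where
    swap : ∀ {w v K} → w ≡ K ⊎ v ≡ K → v ≡ K ⊎ w ≡ K
    swap (inj₁ e) = inj₂ e
    swap (inj₂ e) = inj₁ e

-- The corner (g + p , g + 1) where the second staircase touches the landing is
-- a cut vertex; A consists of the cells up to the end of the landing.
module LastCut (g₁ p₁ d : ℕ) where
  private
    g = suc g₁
    p = suc p₁
    n = g + (p + d)
  B V : ℕ
  B = g₁ + p
  V = g₁

  private
    B+1≡ : B + 1 ≡ g + p
    B+1≡ = arith g₁ p
      where arith : ∀ g₁ p → g₁ + p + 1 ≡ suc g₁ + p
            arith = solve-∀
    V+2≡ : suc g ≡ V + 2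
    V+2≡ = ℕP.+-comm 2 g₁

  inA : ℕ → Bool
  inA m = m <ᵇ B + 1

  window : Window (depth g p) suc B V 3
  window t _ = depth-tail g₁ p₁ t

  window₁ : Window (depth g p) suc B V 1
  window₁ t _ = depth-tail g₁ p₁ t

  window₂ : Window (depth g p) suc B V 2
  window₂ t _ = depth-tail g₁ p₁ t

  cutVertex : CutVertex n (depth g p) inA (shift B V (1 , 2)) (B + 0) (B + 1)
  cutVertex = record
    { cA<n = ℕP.<-≤-trans (subst (B + 0 <_) B+1≡ (ℕP.+-monoʳ-< B (s≤s z≤n))) (subst (g + p ≤_) (ℕP.+-assoc g p d) (ℕP.m≤m+n (g + p) d))
    ; cA∈A = <ᵇ-true (ℕP.+-monoʳ-< B (s≤s z≤n))
    ; crossing = λ { (m , δ) (m' , δ') v w _ _ inA-m inA-m' endv endw a → corner (B + 1) (V + 2) v w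
        (ℕP.≤-trans (end-column≤ (depth g p) v m δ endv) (<ᵇ-true⁻¹ inA-m))
        (ℕP.≤-trans (end-row≤ (depth g p) v m δ endv)
                    (subst (suc (depth g p m) ≤_) V+2≡ (s≤s (depth≤g g p m (subst (m <_) B+1≡ (<ᵇ-true⁻¹ inA-m))))))
        (ℕP.≤-trans (<ᵇ-false⁻¹ inA-m') (end-column≥ (depth g p) w m' δ' endw))
        (ℕP.≤-trans (subst (_≤ depth g p m') V+2≡ (depth>g g p m' (subst (_≤ m') B+1≡ (<ᵇ-false⁻¹ inA-m'))))
                    (end-row≥ (depth g p) w m' δ' endw))
        a }
    ; K-in-A = λ { (m , δ) _ inA-m end → atVertex window₁ (1 , 2)
                    (byComputation suc 0 1 (_≟Pt (1 , 2)) ((0 , upper) ∷ []))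
                    m δ (subst (_≤ m) (sym (ℕP.+-identityʳ B))
                           (ℕP.≤-pred (subst (_≤ suc m) (ℕP.+-comm B 1) (end-column≤ (depth g p) _ m δ end))))
                    (<ᵇ-true⁻¹ inA-m) end }
    ; K-in-B = λ { (m , δ) _ inA-m end → atVertex window₂ (1 , 2)
                    (byComputation suc 1 2 (_≟Pt (1 , 2)) ((1 , upper) ∷ []))
                    m δ (<ᵇ-false⁻¹ inA-m)
                    (subst (m <_) (sym (ℕP.+-suc B 1)) (s≤s (end-column≥ (depth g p) _ m δ end))) end }
    ; near-K-in-B = λ { (m , δ) w _ inA-m end a → nearVertex window (1 , 2)
                    (byComputation suc 1 3 (_∼? (1 , 2)) ((1 , lower) ∷ []))
                    m δ w (<ᵇ-false⁻¹ inA-m)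
                    (subst (m <_) (trans (cong suc (sym (ℕP.+-suc B 1))) (sym (ℕP.+-suc B 2)))
                           (s≤s (near-cell≤ _ w m δ end a))) end a }
    }

-- E_{g,p,d} with g ≥ 2 is not strongly embroiderable: a closed thread starts
-- and finishes in the first two cells, on one side of the cut vertex (g , g).
not-strongly-first : ∀ g₂ p₁ d → ¬ StronglyEmbroiderable (staircase (2 + g₂) (suc p₁) d)
not-strongly-first g₂ p₁ d se =
  cutVertex (FirstCut.cutVertex g₂ p₁ d) (outside (proj₁ ends-in)) (outside (proj₂ ends-in))
  where
  open OnStitching (stitchingOf (2 + g₂) (suc p₁) d (proj₁ se))
  ends-in = endCell-closed (FirstCell.endCell g₂ p₁ d) (stitchingOf-closed (2 + g₂) (suc p₁) d (s≤s z≤n) se)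
  outside : ∀ {m} → m ∈ 0 ∷ 1 ∷ [] → FirstCut.inA g₂ p₁ d m ≡ false
  outside (here refl)         = refl
  outside (there (here refl)) = refl

-- E_{g,p,d} with d ≥ 2 is not strongly embroiderable: a closed thread starts
-- and finishes in the last two cells, beyond the cut vertex (g + p , g + 1).
not-strongly-last : ∀ g₁ p₁ d₂ → ¬ StronglyEmbroiderable (staircase (suc g₁) (suc p₁) (2 + d₂))
not-strongly-last g₁ p₁ d₂ se =
  cutVertex (LastCut.cutVertex g₁ p₁ (2 + d₂)) (outside (proj₁ ends-in)) (outside (proj₂ ends-in))
  where
  open OnStitching (stitchingOf (suc g₁) (suc p₁) (2 + d₂) (proj₁ se))
  open LastCell g₁ p₁ d₂ using (B)
  ends-in = endCell-closed (LastCell.endCell g₁ p₁ d₂) (stitchingOf-closed (suc g₁) (suc p₁) (2 + d₂) (s≤s z≤n) se)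
  beyond : ∀ k → LastCut.B g₁ p₁ (2 + d₂) + 1 ≤ B + suc k
  beyond k = subst₂ _≤_ (ℕP.+-comm 1 (g₁ + suc p₁)) (sym (ℕP.+-suc B k))
               (s≤s (ℕP.≤-trans (ℕP.m≤m+n (g₁ + suc p₁) d₂) (ℕP.m≤m+n B k)))
  outside : ∀ {m} → m ∈ B + 2 ∷ B + 1 ∷ [] → LastCut.inA g₁ p₁ (2 + d₂) m ≡ false
  outside (here refl)         = <ᵇ-false (beyond 1)
  outside (there (here refl)) = <ᵇ-false (beyond 0)

-- If g, d ≥ 2, every embroidery runs from one end cell to the other (end-cell
-- lemma at both ends); the parity colouring then forces p to be odd.
odd-landing : ∀ g₂ p₁ d₂ → Embroiderable (staircase (2 + g₂) (suc p₁) (2 + d₂)) → even? (suc p₁) ≡ false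
odd-landing g₂ p₁ d₂ em =
  fromEnds (endCell (FirstCell.endCell g₂ p₁ (2 + d₂))) (endCell (LastCell.endCell g₁ p₁ d₂))
  where
  g₁ = suc g₂
  g = suc g₁
  p = suc p₁
  S = stitchingOf g p (2 + d₂) em
  open Stitching S using (key; start)
  open OnStitching S using (N; thread-parity; colour-start-key; first<; last<; endCell)
  open LastCell g₁ p₁ d₂ using (B; V; window)

  even-twice : ∀ x y → even? (x + x + y) ≡ even? y
  even-twice zero    y = refl
  even-twice (suc x) y =
    trans (cong (λ z → even? (suc (z + y))) (ℕP.+-suc x x)) (trans (not-involutive _) (even-twice x y))

  colour-last-upper : colour (proj₁ (ends (depth g p) (B + 2 , upper))) ≡ not (even? p)
  colour-last-upper = begin
    even? (B + 2 + depth g p (B + 2))   ≡⟨ cong (λ z → even? (B + 2 + z)) (window 2 (ℕP.n<1+n 2)) ⟩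
    even? (B + 2 + (V + 3))             ≡⟨ cong even? (arith g₁ p₁ d₂) ⟩
    even? (V + V + (5 + p))             ≡⟨ even-twice V (5 + p) ⟩
    not (not (not (not (not (even? p))))) ≡⟨ cong not (trans (not-involutive _) (not-involutive _)) ⟩
    not (even? p) ∎
    where
    open ≡-Reasoning
    arith : ∀ g₁ p₁ d₂ → g₁ + suc p₁ + d₂ + 2 + (g₁ + d₂ + 3) ≡ g₁ + d₂ + (g₁ + d₂) + (5 + suc p₁)
    arith = solve-∀

  colour-last-lower : colour (proj₁ (ends (depth g p) (B + 2 , lower))) ≡ even? p
  colour-last-lower = begin
    even? (B + 2 + 1 + depth g p (B + 2)) ≡⟨ cong (λ z → even? (B + 2 + 1 + z)) (window 2 (ℕP.n<1+n 2)) ⟩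
    even? (B + 2 + 1 + (V + 3))           ≡⟨ cong even? (arith g₁ p₁ d₂) ⟩
    even? (V + V + (6 + p))               ≡⟨ even-twice V (6 + p) ⟩
    not (not (not (not (not (not (even? p)))))) ≡⟨ trans (not-involutive _) (trans (not-involutive _) (not-involutive _)) ⟩
    even? p ∎
    where
    open ≡-Reasoning
    arith : ∀ g₁ p₁ d₂ → g₁ + suc p₁ + d₂ + 2 + 1 + (g₁ + d₂ + 3) ≡ g₁ + d₂ + (g₁ + d₂) + (6 + suc p₁)
    arith = solve-∀

  parity : colour (start (N ∸ 1)) ≡ not (colour (start 0))
  parity = thread-parity (s≤s z≤n)

  colour-first : ∀ {κ} → key 0 ≡ κ → colour (start 0) ≡ colour (proj₁ (ends (depth g p) κ))
  colour-first e = trans (colour-start-key 0 (first< (s≤s z≤n))) (cong (λ κ → colour (proj₁ (ends (depth g p) κ))) e)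

  colour-last : ∀ {κ} → key (N ∸ 1) ≡ κ → colour (start (N ∸ 1)) ≡ colour (proj₁ (ends (depth g p) κ))
  colour-last e = trans (colour-start-key _ (last< (s≤s z≤n))) (cong (λ κ → colour (proj₁ (ends (depth g p) κ))) e)

  not-true : ∀ b → not b ≡ true → b ≡ false
  not-true false _ = refl

  distinctEnds : ∀ δ δ' → _≡_ {A = Key} (0 , δ) (B + 2 , δ') → ⊥
  distinctEnds _ _ ()

  fromEnds : key 0 ≡ (0 , lower) ⊎ key (N ∸ 1) ≡ (0 , upper) →
             key 0 ≡ (B + 2 , lower) ⊎ key (N ∸ 1) ≡ (B + 2 , upper) → even? p ≡ false
  fromEnds (inj₁ a) (inj₁ b) = ⊥-elim (distinctEnds lower lower (trans (sym a) b))
  fromEnds (inj₂ a) (inj₂ b) = ⊥-elim (distinctEnds upper upper (trans (sym a) b))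
  fromEnds (inj₁ a) (inj₂ b) = not-true (even? p) (begin
    not (even? p)                                        ≡⟨ sym colour-last-upper ⟩
    colour (proj₁ (ends (depth g p) (B + 2 , upper)))    ≡⟨ sym (colour-last b) ⟩
    colour (start (N ∸ 1))                               ≡⟨ parity ⟩
    not (colour (start 0))                               ≡⟨ cong not (colour-first a) ⟩
    true ∎)
    where open ≡-Reasoning
  fromEnds (inj₂ a) (inj₁ b) = not-true (even? p) (sym (begin
    true                                                 ≡⟨ sym (colour-last a) ⟩
    colour (start (N ∸ 1))                               ≡⟨ parity ⟩
    not (colour (start 0))                               ≡⟨ cong not (colour-first b) ⟩
    not (colour (proj₁ (ends (depth g p) (B + 2 , lower)))) ≡⟨ cong not colour-last-lower ⟩
    not (even? p) ∎))
    where open ≡-Reasoning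

module Counting where
  open import Data.Fin using (cast; join; splitAt; punchOut)

  injective⇒surjective : ∀ {m} (h : Fin m → Fin m) → (∀ {a b} → h a ≡ h b → a ≡ b) → ∀ y → ∃ λ x → h x ≡ y
  injective⇒surjective {m} h h-inj y with FinP.any? (λ x → h x FinP.≟ y)
  ... | yes hit = hit
  ... | no miss = ⊥-elim (noMiss m h h-inj y miss)
    where
    -- missing y, h would map Fin m injectively into m - 1 values
    noMiss : ∀ m (h : Fin m → Fin m) → (∀ {a b} → h a ≡ h b → a ≡ b) → ∀ y → ¬ (∃ λ x → h x ≡ y) → ⊥
    noMiss (suc m) h h-inj y miss with FinP.pigeonhole (ℕP.n<1+n m) (λ x → punchOut {i = y} {j = h x} (λ e → miss (x , sym e)))
    ... | i , j , i<j , same = ℕP.<-irrefl (cong toℕ (h-inj (FinP.punchOut-injective {i = y}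
                                 (λ e → miss (i , sym e)) (λ e → miss (j , sym e)) same))) i<j

  -- f has a right inverse h; h is injective, hence onto, hence f is injective.
  rightInverse⇒injective : ∀ {m} (f h : Fin m → Fin m) → (∀ y → f (h y) ≡ y) → ∀ {a b} → f a ≡ f b → a ≡ b
  rightInverse⇒injective f h fh {a} {b} e = begin
    a                  ≡⟨ sym (proj₂ (preimage a)) ⟩
    h (proj₁ (preimage a)) ≡⟨ cong h (trans (sym (fh _)) (trans (cong f (proj₂ (preimage a)))
                                (trans e (trans (sym (cong f (proj₂ (preimage b)))) (fh _))))) ⟩
    h (proj₁ (preimage b)) ≡⟨ proj₂ (preimage b) ⟩
    b ∎
    where
    open ≡-Reasoning
    preimage = injective⇒surjective h (λ {a} {b} e → trans (sym (fh a)) (trans (cong f e) (fh b)))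

  private
    to2n : ∀ n → n + n ≡ 2 * n
    to2n n = cong (λ z → n + z) (sym (ℕP.+-identityʳ n))
    from2n : ∀ n → 2 * n ≡ n + n
    from2n n = cong (λ z → n + z) (ℕP.+-identityʳ n)

    asSum : ∀ {n} → Fin n × Diag → Fin n ⊎ Fin n
    asSum (i , lower) = inj₁ i
    asSum (i , upper) = inj₂ i

    fromSum : ∀ {n} → Fin n ⊎ Fin n → Fin n × Diag
    fromSum (inj₁ i) = i , lower
    fromSum (inj₂ i) = i , upper

    asSum-fromSum : ∀ {n} (s : Fin n ⊎ Fin n) → asSum (fromSum s) ≡ s
    asSum-fromSum (inj₁ _) = refl
    asSum-fromSum (inj₂ _) = refl

  encode : ∀ n → Fin n × Diag → Fin (2 * n)
  encode n κ = cast (to2n n) (join n n (asSum κ))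

  decode : ∀ n → Fin (2 * n) → Fin n × Diag
  decode n y = fromSum (splitAt n (cast (from2n n) y))

  encode-decode : ∀ n y → encode n (decode n y) ≡ y
  encode-decode n y =
    trans (cong (cast (to2n n)) (trans (cong (join n n) (asSum-fromSum (splitAt n (cast (from2n n) y))))
                                       (FinP.join-splitAt n n (cast (from2n n) y))))
          (FinP.cast-involutive (to2n n) (from2n n) y)

  surjective⇒injective : ∀ {n} (σ : Fin (2 * n) → Fin n × Diag) → (∀ y → ∃ λ x → σ x ≡ y) → ∀ {a b} → σ a ≡ σ b → a ≡ b
  surjective⇒injective {n} σ onto e =
    rightInverse⇒injective (λ x → encode n (σ x)) (λ y → proj₁ (onto (decode n y)))
      (λ y → trans (cong (encode n) (proj₂ (onto (decode n y)))) (encode-decode n y)) (cong (encode n) e)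

-- A stitch records the diagonal sewn and the
-- points it runs from and to; a plan is a list of stitches that sews every
-- diagonal of the staircase, in a chain of unit back stitches, lower diagonals
-- first.
Stitch : Set
Stitch = Key × (Pt × Pt)

key : Stitch → Key
key = proj₁

from to : Stitch → Pt
from st = proj₁ (proj₂ st)
to   st = proj₂ (proj₂ st)

Chain : List Stitch → Set
Chain []           = ⊤
Chain (_ ∷ [])     = ⊤
Chain (s ∷ t ∷ L)  = to s ∼ from t × Chain (t ∷ L)

-- An upper diagonal is sewn only after the lower one of its cell, counting the
-- keys in `Sewn` as sewn before the list starts.
LowerFirst : (Key → Set) → List Stitch → Set
LowerFirst Sewn []       = ⊤
LowerFirst Sewn (s ∷ L)  = (proj₂ (key s) ≡ upper → Sewn (proj₁ (key s) , lower))
                          × LowerFirst (λ κ → Sewn κ ⊎ κ ≡ key s) L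

record Sews (g p n : ℕ) (s : Stitch) : Set where
  constructor sewing
  field
    cell<    : proj₁ (key s) < n
    diagonal : Traverses (from s) (to s) (ends (depth g p) (key s))

Covers : List Stitch → Key → Set
Covers L κ = Any (λ s → key s ≡ κ) L

record Plan (g p d : ℕ) (L : List Stitch) : Set where
  field
    length≡    : length L ≡ 2 * (g + (p + d))
    sews       : All (Sews g p (g + (p + d))) L
    chain      : Chain L
    covers     : ∀ c δ → c < g + (p + d) → Covers L (c , δ)
    lowerFirst : LowerFirst (λ _ → ⊥) L

nthOr : ∀ {A : Set} → A → List A → ℕ → A
nthOr x₀ []       _       = x₀
nthOr x₀ (x ∷ xs) zero    = x
nthOr x₀ (x ∷ xs) (suc k) = nthOr x₀ xs k

nth : List Stitch → ℕ → Stitch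
nth = nthOr ((0 , lower) , ((0 , 0) , (0 , 0)))

thread : List Stitch → List Pt
thread []      = []
thread (s ∷ L) = from s ∷ to s ∷ thread L

thread-even : ∀ L k → nthOr (0 , 0) (thread L) (k + k) ≡ from (nth L k)
thread-even []      k       = refl
thread-even (s ∷ L) zero    = refl
thread-even (s ∷ L) (suc k) = trans (cong (nthOr (0 , 0) (thread (s ∷ L))) (cong suc (ℕP.+-suc k k))) (thread-even L k)

thread-odd : ∀ L k → nthOr (0 , 0) (thread L) (suc (k + k)) ≡ to (nth L k)
thread-odd []      k       = refl
thread-odd (s ∷ L) zero    = refl
thread-odd (s ∷ L) (suc k) =
  trans (cong (nthOr (0 , 0) (thread (s ∷ L))) (cong (λ z → suc (suc z)) (ℕP.+-suc k k))) (thread-odd L k)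

chain-at : ∀ L k → Chain L → suc k < length L → to (nth L k) ∼ from (nth L (suc k))
chain-at (s ∷ t ∷ L) zero    (a , _) _         = a
chain-at (s ∷ t ∷ L) (suc k) (_ , c) (s≤s k<) = chain-at (t ∷ L) k c k<
chain-at (s ∷ [])    _       _       (s≤s ())

all-at : ∀ {P : Stitch → Set} L k → All P L → k < length L → P (nth L k)
all-at (s ∷ L) zero    (ps ∷ _) _         = ps
all-at (s ∷ L) (suc k) (_ ∷ ps) (s≤s k<) = all-at L k ps k<

covers-at : ∀ {κ} L → Covers L κ → ∃ λ k → k < length L × key (nth L k) ≡ κ
covers-at (s ∷ L) (here e) = 0 , s≤s z≤n , e
covers-at (s ∷ L) (there c) with covers-at L c
... | k , k< , e = suc k , s≤s k< , e

lowerFirst-at : ∀ Sewn L k c → LowerFirst Sewn L → k < length L → key (nth L k) ≡ (c , upper) →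
                Sewn (c , lower) ⊎ ∃ λ j → j < k × key (nth L j) ≡ (c , lower)
lowerFirst-at Sewn (s ∷ L) zero    c (first , _) _ e =
  inj₁ (subst (λ z → Sewn (z , lower)) (cong proj₁ e) (first (cong proj₂ e)))
lowerFirst-at Sewn (s ∷ L) (suc k) c (_ , rest) (s≤s k<) e with lowerFirst-at _ L k c rest k< e
... | inj₁ (inj₁ sewn)       = inj₁ sewn
... | inj₁ (inj₂ e′)         = inj₂ (0 , s≤s z≤n , sym e′)
... | inj₂ (j , j<k , e′)    = inj₂ (suc j , s≤s j<k , e′)

module FromPlan {g p d : ℕ} {L : List Stitch} (P : Plan g p d L) where
  open Plan P
  private
    C  = staircase g p d
    n  = length C
    n≡ : n ≡ g + (p + d)
    n≡ = length-staircase g p d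

    length≡2n : length L ≡ 2 * n
    length≡2n = trans length≡ (cong (2 *_) (sym n≡))

    x : ℕ → Point
    x i = toPoint (nthOr (0 , 0) (thread L) i)

    x-from : ∀ k → x (2 * k) ≡ toPoint (from (nth L k))
    x-from k = cong toPoint (trans (cong (nthOr (0 , 0) (thread L)) (cong (λ z → k + z) (ℕP.+-identityʳ k))) (thread-even L k))

    x-to : ∀ k → x (suc (2 * k)) ≡ toPoint (to (nth L k))
    x-to k = cong toPoint (trans (cong (λ z → nthOr (0 , 0) (thread L) (suc z)) (cong (λ z → k + z) (ℕP.+-identityʳ k)))
                                 (thread-odd L k))

    in-list : (k : Fin (2 * n)) → toℕ k < length L
    in-list k = subst (toℕ k <_) (sym length≡2n) (FinP.toℕ<n k)

    cell< : ∀ k → k < length L → proj₁ (key (nth L k)) < n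
    cell< k k< = subst (_ <_) (sym n≡) (Sews.cell< (all-at L k sews k<))

    σ : Fin (2 * n) → Fin n × Diag
    σ k = fromℕ< (cell< (toℕ k) (in-list k)) , proj₂ (key (nth L (toℕ k)))

    σ-key : ∀ k → (toℕ (proj₁ (σ k)) , proj₂ (σ k)) ≡ key (nth L (toℕ k))
    σ-key k = cong (_, proj₂ (key (nth L (toℕ k)))) (FinP.toℕ-fromℕ< (cell< (toℕ k) (in-list k)))

    σ-onto : ∀ y → ∃ λ k → σ k ≡ y
    σ-onto (i , δ) with covers-at L (covers (toℕ i) δ (subst (toℕ i <_) n≡ (FinP.toℕ<n i)))
    ... | k , k< , e = k′ , cong₂ _,_ (FinP.toℕ-injective (trans (cong proj₁ (σ-key k′))
                                                   (trans (cong (λ j → proj₁ (key (nth L j))) k′≡) (cong proj₁ e))))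
                                      (trans (cong (λ j → proj₂ (key (nth L j))) k′≡) (cong proj₂ e))
      where
      k′ : Fin (2 * n)
      k′ = fromℕ< (subst (k <_) length≡2n k<)
      k′≡ : toℕ k′ ≡ k
      k′≡ = FinP.toℕ-fromℕ< (subst (k <_) length≡2n k<)

    σ-injective : ∀ {a b} → σ a ≡ σ b → a ≡ b
    σ-injective = Counting.surjective⇒injective σ σ-onto

    front′ : ∀ k → SameSeg (x (2 * toℕ k)) (x (suc (2 * toℕ k))) (diagEnds (lookup C (proj₁ (σ k))) (proj₂ (σ k)))
    front′ k = subst₂ (λ A B → SameSeg A B (diagEnds (lookup C (proj₁ (σ k))) (proj₂ (σ k))))
                 (sym (x-from (toℕ k))) (sym (x-to (toℕ k)))
                 (subst (SameSeg (toPoint (from s)) (toPoint (to s)))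
                    (sym (trans (cong (λ c → diagEnds c (proj₂ (σ k))) (lookup-staircase g p d (proj₁ (σ k))))
                           (trans (diagEnds-cellAt g p (toℕ (proj₁ (σ k))) (proj₂ (σ k)))
                                  (cong (λ κ → toPoints (ends (depth g p) κ)) (σ-key k)))))
                    (inPoints (Sews.diagonal (all-at L (toℕ k) sews (in-list k)))))
      where
      s = nth L (toℕ k)
      inPoints : ∀ {A B E} → Traverses A B E → SameSeg (toPoint A) (toPoint B) (toPoints E)
      inPoints (inj₁ (refl , refl)) = inj₁ (refl , refl)
      inPoints (inj₂ (refl , refl)) = inj₂ (refl , refl)

    lowerFirst′ : ∀ k k' i → σ k ≡ (i , lower) → σ k' ≡ (i , upper) → toℕ k < toℕ k'
    lowerFirst′ k k' i e e'
      with lowerFirst-at (λ _ → ⊥) L (toℕ k') (toℕ i) lowerFirst (in-list k')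
             (trans (sym (σ-key k')) (cong (λ z → (toℕ (proj₁ z) , proj₂ z)) e'))
    ... | inj₂ (j , j<k' , ej) = subst (_< toℕ k') (trans (sym j′≡) (cong toℕ same)) j<k'
      where
      j< : j < 2 * n
      j< = ℕP.<-trans j<k' (FinP.toℕ<n k')
      j′ = fromℕ< j<
      j′≡ : toℕ j′ ≡ j
      j′≡ = FinP.toℕ-fromℕ< j<
      same : j′ ≡ k
      same = σ-injective (trans (cong₂ _,_
        (FinP.toℕ-injective (trans (cong proj₁ (σ-key j′)) (trans (cong (λ z → proj₁ (key (nth L z))) j′≡) (cong proj₁ ej))))
        (trans (cong (λ z → proj₂ (key (nth L z))) j′≡) (cong proj₂ ej))) (sym e))

    back′ : ∀ k → k < 2 * n ∸ 1 → Adjacent (x (suc (2 * k))) (x (2 + 2 * k))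
    back′ k k< = subst₂ Adjacent (sym (x-to k)) (sym (trans (cong x (cong suc (sym (ℕP.+-suc k (k + 0))))) (x-from (suc k))))
                   (∼⇒adjacent _ _ (chain-at L k chain k+1<))
      where
      below-last : ∀ {i m} → i < m ∸ 1 → suc i < m
      below-last {m = suc m} i< = s≤s i<
      k+1< : suc k < length L
      k+1< = subst (suc k <_) (sym length≡2n) (below-last k<)

  embroidery : Embroiderable (staircase g p d)
  embroidery = record
    { x = x
    ; σ = σ
    ; σ-bij = σ-injective , (λ y → proj₁ (σ-onto y) , λ { refl → proj₂ (σ-onto y) })
    ; front = front′
    ; lowerFirst = lowerFirst′
    ; back = back′
    }

  strongEmbroidery : 0 < g + (p + d) → to (nth L (2 * (g + (p + d)) ∸ 1)) ∼ from (nth L 0) →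
                     StronglyEmbroiderable (staircase g p d)
  strongEmbroidery n>0 closes = embroidery , subst₂ Adjacent (sym x-last) (sym (x-from 0)) (∼⇒adjacent _ _ closes)
    where
    x-last : x (4 * n ∸ 1) ≡ toPoint (to (nth L (2 * (g + (p + d)) ∸ 1)))
    x-last = trans (cong x (sym (last-index n (subst (0 <_) (sym n≡) n>0))))
                   (trans (x-to (2 * n ∸ 1)) (cong (λ m → toPoint (to (nth L (2 * m ∸ 1)))) n≡))


double-suc : ∀ k → suc (suc (2 * k)) ≡ 2 * suc k
double-suc = solve-∀

-- The lower / upper diagonal of cell m at depth v, sewn rightwards (true) or leftwards (false).
lowerSt : ℕ → ℕ → Bool → Stitch
lowerSt m v true  = (m , lower) , ((m , suc v) , (m + 1 , v))
lowerSt m v false = (m , lower) , ((m + 1 , v) , (m , suc v))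

upperSt : ℕ → ℕ → Bool → Stitch
upperSt m v true  = (m , upper) , ((m , v) , (m + 1 , suc v))
upperSt m v false = (m , upper) , ((m + 1 , suc v) , (m , v))

lowerSt-sews : ∀ {g p n m v} o → m < n → depth g p m ≡ v → Sews g p n (lowerSt m v o)
lowerSt-sews {m = m} true  m< e = sewing m< (inj₂ (cong (m ,_) (cong suc (sym e)) , cong (m + 1 ,_) (sym e)))
lowerSt-sews {m = m} false m< e = sewing m< (inj₁ (cong (m + 1 ,_) (sym e) , cong (m ,_) (cong suc (sym e))))

upperSt-sews : ∀ {g p n m v} o → m < n → depth g p m ≡ v → Sews g p n (upperSt m v o)
upperSt-sews {m = m} true  m< e = sewing m< (inj₁ (cong (m ,_) (sym e) , cong (m + 1 ,_) (cong suc (sym e))))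
upperSt-sews {m = m} false m< e = sewing m< (inj₂ (cong (m + 1 ,_) (cong suc (sym e)) , cong (m ,_) (sym e)))

step-west : ∀ m v → (m + 1 , v) ∼ (m , v)
step-west m v = west (ℕP.+-comm m 1) refl

step-east : ∀ m v → (m , v) ∼ (m + 1 , v)
step-east m v = east (ℕP.+-comm m 1) refl

step-south : ∀ m v → (m , v) ∼ (m , suc v)
step-south m v = south refl refl

step-north : ∀ m v → (m , suc v) ∼ (m , v)
step-north m v = north refl refl

∼-cong : ∀ {A B A' B'} → A ≡ A' → B ≡ B' → A ∼ B → A' ∼ B'
∼-cong refl refl a = a

lastOf : Stitch → List Stitch → Stitch
lastOf s []      = s
lastOf s (t ∷ L) = lastOf t L

lastOf-++ : ∀ s A t B → lastOf s (A ++ t ∷ B) ≡ lastOf t B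
lastOf-++ s []      t B = refl
lastOf-++ s (a ∷ A) t B = lastOf-++ a A t B

nth-last : ∀ s A → nth (s ∷ A) (length (s ∷ A) ∸ 1) ≡ lastOf s A
nth-last s []      = refl
nth-last s (a ∷ A) = nth-last a A

chain-++ : ∀ s A t B → Chain (s ∷ A) → Chain (t ∷ B) → to (lastOf s A) ∼ from t → Chain ((s ∷ A) ++ (t ∷ B))
chain-++ s []       t B _        cB join = join , cB
chain-++ s (s' ∷ A) t B (a , cA) cB join = a , chain-++ s' A t B cA cB join

sewnAfter : (Key → Set) → List Stitch → Key → Set
sewnAfter Sewn []      = Sewn
sewnAfter Sewn (s ∷ A) = sewnAfter (λ κ → Sewn κ ⊎ κ ≡ key s) A

lowerFirst-++ : ∀ Sewn A B → LowerFirst Sewn A → LowerFirst (sewnAfter Sewn A) B → LowerFirst Sewn (A ++ B)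
lowerFirst-++ Sewn []      B _            lB = lB
lowerFirst-++ Sewn (s ∷ A) B (first , lA) lB = first , lowerFirst-++ _ A B lA lB

lowerFirst-mono : ∀ Sewn Sewn' L → (∀ κ → Sewn κ → Sewn' κ) → LowerFirst Sewn L → LowerFirst Sewn' L
lowerFirst-mono Sewn Sewn' []      f _           = tt
lowerFirst-mono Sewn Sewn' (s ∷ L) f (first , l) =
  (λ e → f _ (first e)) , lowerFirst-mono _ _ L (λ { κ (inj₁ x) → inj₁ (f κ x) ; κ (inj₂ y) → inj₂ y }) l

sewnAfter-before : ∀ Sewn A κ → Sewn κ → sewnAfter Sewn A κ
sewnAfter-before Sewn []      κ s = s
sewnAfter-before Sewn (t ∷ A) κ s = sewnAfter-before _ A κ (inj₁ s)

sewnAfter-covers : ∀ Sewn A κ → Covers A κ → sewnAfter Sewn A κ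
sewnAfter-covers Sewn (t ∷ A) κ (here e)  = sewnAfter-before _ A κ (inj₂ (sym e))
sewnAfter-covers Sewn (t ∷ A) κ (there c) = sewnAfter-covers _ A κ c

record Row (g p n B V k : ℕ) : Set where
  constructor row
  field cell : ∀ i → i < k → B + i < n × depth g p (B + i) ≡ V

record Stair (g p n B V k : ℕ) : Set where
  constructor stair
  field cell : ∀ i → i < k → B + i < n × depth g p (B + i) ≡ V + i

module _ {g p n : ℕ} where
  row-last : ∀ {B V k} → Row g p n B V (suc k) → B + k < n × depth g p (B + k) ≡ V
  row-last (row r) = r _ ℕP.≤-refl

  row-head : ∀ {B V k} → Row g p n B V (suc k) → B < n × depth g p B ≡ V
  row-head {B} (row r) = subst (_< n) (ℕP.+-identityʳ B) (proj₁ (r 0 (s≤s z≤n))) ,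
                         trans (cong (depth g p) (sym (ℕP.+-identityʳ B))) (proj₂ (r 0 (s≤s z≤n)))

  row-tail : ∀ {B V k} → Row g p n B V (suc k) → Row g p n (suc B) V k
  row-tail {B} (row r) = row λ i i< → subst (_< n) (ℕP.+-suc B i) (proj₁ (r (suc i) (s≤s i<))) ,
                                      trans (cong (depth g p) (sym (ℕP.+-suc B i))) (proj₂ (r (suc i) (s≤s i<)))

  row-init : ∀ {B V k} → Row g p n B V (suc k) → Row g p n B V k
  row-init (row r) = row λ i i< → r i (ℕP.m≤n⇒m≤1+n i<)

  stair-last : ∀ {B V k} → Stair g p n B V (suc k) → B + k < n × depth g p (B + k) ≡ V + k
  stair-last (stair s) = s _ ℕP.≤-refl

  stair-head : ∀ {B V k} → Stair g p n B V (suc k) → B < n × depth g p B ≡ V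
  stair-head {B} {V} (stair s) = subst (_< n) (ℕP.+-identityʳ B) (proj₁ (s 0 (s≤s z≤n))) ,
    trans (cong (depth g p) (sym (ℕP.+-identityʳ B))) (trans (proj₂ (s 0 (s≤s z≤n))) (ℕP.+-identityʳ V))

  stair-tail : ∀ {B V k} → Stair g p n B V (suc k) → Stair g p n (suc B) (suc V) k
  stair-tail {B} {V} (stair s) = stair λ i i< → subst (_< n) (ℕP.+-suc B i) (proj₁ (s (suc i) (s≤s i<))) ,
    trans (cong (depth g p) (sym (ℕP.+-suc B i))) (trans (proj₂ (s (suc i) (s≤s i<))) (ℕP.+-suc V i))

  stair-init : ∀ {B V k} → Stair g p n B V (suc k) → Stair g p n B V k
  stair-init (stair s) = stair λ i i< → s i (ℕP.m≤n⇒m≤1+n i<)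

descending : ℕ → ℕ → ℕ → List Stitch
descending B V zero    = []
descending B V (suc k) = lowerSt B V true ∷ upperSt B V true ∷ descending (suc B) (suc V) k

descending-length : ∀ B V k → length (descending B V k) ≡ 2 * k
descending-length B V zero    = refl
descending-length B V (suc k) = trans (cong (λ z → suc (suc z)) (descending-length (suc B) (suc V) k)) (double-suc k)

descending-sews : ∀ {g p n} B V k → Stair g p n B V k → All (Sews g p n) (descending B V k)
descending-sews B V zero    s = []
descending-sews B V (suc k) s =
  lowerSt-sews true (proj₁ (stair-head s)) (proj₂ (stair-head s)) ∷
  upperSt-sews true (proj₁ (stair-head s)) (proj₂ (stair-head s)) ∷
  descending-sews (suc B) (suc V) k (stair-tail s)

descending-chain : ∀ B V k → Chain (descending B V k)
descending-chain B V zero          = tt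
descending-chain B V (suc zero)    = step-west B V , tt
descending-chain B V (suc (suc k)) =
  step-west B V , ∼-cong (cong (_, suc V) (sym (ℕP.+-comm B 1))) refl (step-south (suc B) (suc V)) ,
  descending-chain (suc B) (suc V) (suc k)

descending-last : ∀ B V k → to (lastOf (lowerSt B V true) (upperSt B V true ∷ descending (suc B) (suc V) k)) ≡ (B + suc k , V + suc k)
descending-last B V zero    = cong₂ _,_ refl (ℕP.+-comm 1 V)
descending-last B V (suc k) =
  trans (descending-last (suc B) (suc V) k) (cong₂ _,_ (sym (ℕP.+-suc B (suc k))) (sym (ℕP.+-suc V (suc k))))

descending-lowerFirst : ∀ Sewn B V k → LowerFirst Sewn (descending B V k)
descending-lowerFirst Sewn B V zero    = tt
descending-lowerFirst Sewn B V (suc k) =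
  (λ ()) , (λ _ → inj₂ refl) , lowerFirst-mono _ _ (descending (suc B) (suc V) k) (λ _ ()) (descending-lowerFirst (λ _ → ⊥) (suc B) (suc V) k)

descending-covers : ∀ B V k i δ → i < k → Covers (descending B V k) (B + i , δ)
descending-covers B V (suc k) zero    lower _ = here (cong (_, lower) (sym (ℕP.+-identityʳ B)))
descending-covers B V (suc k) zero    upper _ = there (here (cong (_, upper) (sym (ℕP.+-identityʳ B))))
descending-covers B V (suc k) (suc i) δ (s≤s i<) =
  there (there (subst (λ z → Covers (descending (suc B) (suc V) k) (z , δ)) (sym (ℕP.+-suc B i))
                      (descending-covers (suc B) (suc V) k i δ i<)))

ascending : ℕ → ℕ → ℕ → List Stitch
ascending B V zero    = []
ascending B V (suc k) = lowerSt (B + k) (V + k) false ∷ upperSt (B + k) (V + k) false ∷ ascending B V k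

ascending-length : ∀ B V k → length (ascending B V k) ≡ 2 * k
ascending-length B V zero    = refl
ascending-length B V (suc k) = trans (cong (λ z → suc (suc z)) (ascending-length B V k)) (double-suc k)

ascending-sews : ∀ {g p n} B V k → Stair g p n B V k → All (Sews g p n) (ascending B V k)
ascending-sews B V zero    s = []
ascending-sews B V (suc k) s =
  lowerSt-sews false (proj₁ (stair-last s)) (proj₂ (stair-last s)) ∷
  upperSt-sews false (proj₁ (stair-last s)) (proj₂ (stair-last s)) ∷
  ascending-sews B V k (stair-init s)

ascending-chain : ∀ B V k → Chain (ascending B V k)
ascending-chain B V zero          = tt
ascending-chain B V (suc zero)    = step-east _ _ , tt
ascending-chain B V (suc (suc k)) =
  step-east _ _ ,
  ∼-cong (cong₂ _,_ (trans (ℕP.+-assoc B k 1) (cong (λ z → B + z) (ℕP.+-comm k 1))) (sym (ℕP.+-suc V k))) refl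
         (step-north (B + k + 1) (V + k)) ,
  ascending-chain B V (suc k)

ascending-last : ∀ B V k → to (lastOf (lowerSt (B + k) (V + k) false) (upperSt (B + k) (V + k) false ∷ ascending B V k)) ≡ (B + 0 , V + 0)
ascending-last B V zero    = refl
ascending-last B V (suc k) = ascending-last B V k

ascending-lowerFirst : ∀ Sewn B V k → LowerFirst Sewn (ascending B V k)
ascending-lowerFirst Sewn B V zero    = tt
ascending-lowerFirst Sewn B V (suc k) =
  (λ ()) , (λ _ → inj₂ refl) , lowerFirst-mono _ _ (ascending B V k) (λ _ ()) (ascending-lowerFirst (λ _ → ⊥) B V k)

ascending-covers : ∀ B V k i δ → i < k → Covers (ascending B V k) (B + i , δ)
ascending-covers B V (suc k) i δ i< with ℕP.m≤n⇒m<n∨m≡n (ℕP.≤-pred i<)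
ascending-covers B V (suc k) i lower i< | inj₂ refl = here refl
ascending-covers B V (suc k) i upper i< | inj₂ refl = there (here refl)
... | inj₁ i<k = there (there (ascending-covers B V k i δ i<k))

lowersRight : ℕ → ℕ → ℕ → List Stitch
lowersRight B V zero    = []
lowersRight B V (suc k) = lowerSt B V true ∷ lowersRight (suc B) V k

lowersRight-length : ∀ B V k → length (lowersRight B V k) ≡ k
lowersRight-length B V zero    = refl
lowersRight-length B V (suc k) = cong suc (lowersRight-length (suc B) V k)

lowersRight-sews : ∀ {g p n} B V k → Row g p n B V k → All (Sews g p n) (lowersRight B V k)
lowersRight-sews B V zero    r = []
lowersRight-sews B V (suc k) r = lowerSt-sews true (proj₁ (row-head r)) (proj₂ (row-head r)) ∷ lowersRight-sews (suc B) V k (row-tail r)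

lowersRight-chain : ∀ B V k → Chain (lowersRight B V k)
lowersRight-chain B V zero          = tt
lowersRight-chain B V (suc zero)    = tt
lowersRight-chain B V (suc (suc k)) =
  ∼-cong (cong (_, V) (sym (ℕP.+-comm B 1))) refl (step-south (suc B) V) , lowersRight-chain (suc B) V (suc k)

lowersRight-last : ∀ B V k → to (lastOf (lowerSt B V true) (lowersRight (suc B) V k)) ≡ (B + suc k , V)
lowersRight-last B V zero    = refl
lowersRight-last B V (suc k) = trans (lowersRight-last (suc B) V k) (cong (_, V) (sym (ℕP.+-suc B (suc k))))

lowersRight-lowerFirst : ∀ Sewn B V k → LowerFirst Sewn (lowersRight B V k)
lowersRight-lowerFirst Sewn B V zero    = tt
lowersRight-lowerFirst Sewn B V (suc k) = (λ ()) , lowersRight-lowerFirst _ (suc B) V k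

lowersRight-covers : ∀ B V k i → i < k → Covers (lowersRight B V k) (B + i , lower)
lowersRight-covers B V (suc k) zero    _ = here (cong (_, lower) (sym (ℕP.+-identityʳ B)))
lowersRight-covers B V (suc k) (suc i) (s≤s i<) =
  there (subst (λ z → Covers (lowersRight (suc B) V k) (z , lower)) (sym (ℕP.+-suc B i)) (lowersRight-covers (suc B) V k i i<))

lowersLeft : ℕ → ℕ → ℕ → List Stitch
lowersLeft B V zero    = []
lowersLeft B V (suc k) = lowerSt (B + k) V false ∷ lowersLeft B V k

lowersLeft-length : ∀ B V k → length (lowersLeft B V k) ≡ k
lowersLeft-length B V zero    = refl
lowersLeft-length B V (suc k) = cong suc (lowersLeft-length B V k)

lowersLeft-sews : ∀ {g p n} B V k → Row g p n B V k → All (Sews g p n) (lowersLeft B V k)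
lowersLeft-sews B V zero    r = []
lowersLeft-sews B V (suc k) r = lowerSt-sews false (proj₁ (row-last r)) (proj₂ (row-last r)) ∷ lowersLeft-sews B V k (row-init r)

lowersLeft-chain : ∀ B V k → Chain (lowersLeft B V k)
lowersLeft-chain B V zero          = tt
lowersLeft-chain B V (suc zero)    = tt
lowersLeft-chain B V (suc (suc k)) =
  ∼-cong (cong (_, suc V) (trans (ℕP.+-assoc B k 1) (cong (λ z → B + z) (ℕP.+-comm k 1)))) refl (step-north (B + k + 1) V) ,
  lowersLeft-chain B V (suc k)

lowersLeft-last : ∀ B V k → to (lastOf (lowerSt (B + k) V false) (lowersLeft B V k)) ≡ (B + 0 , suc V)
lowersLeft-last B V zero    = refl
lowersLeft-last B V (suc k) = lowersLeft-last B V k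

lowersLeft-lowerFirst : ∀ Sewn B V k → LowerFirst Sewn (lowersLeft B V k)
lowersLeft-lowerFirst Sewn B V zero    = tt
lowersLeft-lowerFirst Sewn B V (suc k) = (λ ()) , lowersLeft-lowerFirst _ B V k

lowersLeft-covers : ∀ B V k i → i < k → Covers (lowersLeft B V k) (B + i , lower)
lowersLeft-covers B V (suc k) i i< with ℕP.m≤n⇒m<n∨m≡n (ℕP.≤-pred i<)
... | inj₂ refl = here refl
... | inj₁ i<k  = there (lowersLeft-covers B V k i i<k)

uppersRight : ℕ → ℕ → ℕ → List Stitch
uppersRight B V zero    = []
uppersRight B V (suc k) = upperSt B V true ∷ uppersRight (suc B) V k

uppersRight-length : ∀ B V k → length (uppersRight B V k) ≡ k
uppersRight-length B V zero    = refl
uppersRight-length B V (suc k) = cong suc (uppersRight-length (suc B) V k)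

uppersRight-sews : ∀ {g p n} B V k → Row g p n B V k → All (Sews g p n) (uppersRight B V k)
uppersRight-sews B V zero    r = []
uppersRight-sews B V (suc k) r = upperSt-sews true (proj₁ (row-head r)) (proj₂ (row-head r)) ∷ uppersRight-sews (suc B) V k (row-tail r)

uppersRight-chain : ∀ B V k → Chain (uppersRight B V k)
uppersRight-chain B V zero          = tt
uppersRight-chain B V (suc zero)    = tt
uppersRight-chain B V (suc (suc k)) =
  ∼-cong (cong (_, suc V) (sym (ℕP.+-comm B 1))) refl (step-north (suc B) V) , uppersRight-chain (suc B) V (suc k)

uppersRight-lowerFirst : ∀ Sewn B V k → (∀ i → i < k → Sewn (B + i , lower)) → LowerFirst Sewn (uppersRight B V k)
uppersRight-lowerFirst Sewn B V zero    h = tt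
uppersRight-lowerFirst Sewn B V (suc k) h =
  (λ _ → subst (λ z → Sewn (z , lower)) (ℕP.+-identityʳ B) (h 0 (s≤s z≤n))) ,
  uppersRight-lowerFirst _ (suc B) V k (λ i i< → inj₁ (subst (λ z → Sewn (z , lower)) (ℕP.+-suc B i) (h (suc i) (s≤s i<))))

uppersRight-covers : ∀ B V k i → i < k → Covers (uppersRight B V k) (B + i , upper)
uppersRight-covers B V (suc k) zero    _ = here (cong (_, upper) (sym (ℕP.+-identityʳ B)))
uppersRight-covers B V (suc k) (suc i) (s≤s i<) =
  there (subst (λ z → Covers (uppersRight (suc B) V k) (z , upper)) (sym (ℕP.+-suc B i)) (uppersRight-covers (suc B) V k i i<))

uppersLeft : ℕ → ℕ → ℕ → List Stitch
uppersLeft B V zero    = []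
uppersLeft B V (suc k) = upperSt (B + k) V false ∷ uppersLeft B V k

uppersLeft-length : ∀ B V k → length (uppersLeft B V k) ≡ k
uppersLeft-length B V zero    = refl
uppersLeft-length B V (suc k) = cong suc (uppersLeft-length B V k)

uppersLeft-sews : ∀ {g p n} B V k → Row g p n B V k → All (Sews g p n) (uppersLeft B V k)
uppersLeft-sews B V zero    r = []
uppersLeft-sews B V (suc k) r = upperSt-sews false (proj₁ (row-last r)) (proj₂ (row-last r)) ∷ uppersLeft-sews B V k (row-init r)

uppersLeft-chain : ∀ B V k → Chain (uppersLeft B V k)
uppersLeft-chain B V zero          = tt
uppersLeft-chain B V (suc zero)    = tt
uppersLeft-chain B V (suc (suc k)) =
  ∼-cong refl (cong (_, suc V) (trans (ℕP.+-suc B k) (sym (ℕP.+-comm (B + k) 1)))) (step-south (B + suc k) V) ,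
  uppersLeft-chain B V (suc k)

uppersLeft-last : ∀ B V k → to (lastOf (upperSt (B + k) V false) (uppersLeft B V k)) ≡ (B , V)
uppersLeft-last B V zero    = cong (_, V) (ℕP.+-identityʳ B)
uppersLeft-last B V (suc k) = uppersLeft-last B V k

uppersLeft-lowerFirst : ∀ Sewn B V k → (∀ i → i < k → Sewn (B + i , lower)) → LowerFirst Sewn (uppersLeft B V k)
uppersLeft-lowerFirst Sewn B V zero    h = tt
uppersLeft-lowerFirst Sewn B V (suc k) h =
  (λ _ → h k ℕP.≤-refl) , uppersLeft-lowerFirst _ B V k (λ i i< → inj₁ (h i (ℕP.<-trans i< (ℕP.n<1+n k))))

uppersLeft-covers : ∀ B V k i → i < k → Covers (uppersLeft B V k) (B + i , upper)
uppersLeft-covers B V (suc k) i i< with ℕP.m≤n⇒m<n∨m≡n (ℕP.≤-pred i<)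
... | inj₂ refl = here refl
... | inj₁ i<k  = there (uppersLeft-covers B V k i i<k)

-- `zigzag B V r`: on a row of 2r + 1 cells B, …, B + 2r whose first lower
-- diagonal is already sewn, the lower diagonals of cells B + 1, …, B + 2r and
-- the upper diagonals of cells B, …, B + 2r - 1, two cells per block; the
-- thread ends at the bottom-left corner of the last cell B + 2r.
zigzag : ℕ → ℕ → ℕ → List Stitch
zigzag B V zero    = []
zigzag B V (suc r) =
  lowerSt (B + 1) V true ∷ lowerSt (B + 2) V false ∷ upperSt B V false ∷ upperSt (B + 1) V true ∷ zigzag (B + 2) V r

zigzag-length : ∀ B V r → length (zigzag B V r) ≡ 4 * r
zigzag-length B V zero    = refl
zigzag-length B V (suc r) = trans (cong (λ z → suc (suc (suc (suc z)))) (zigzag-length (B + 2) V r)) (arith r)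
  where arith : ∀ r → suc (suc (suc (suc (4 * r)))) ≡ 4 * suc r
        arith = solve-∀

zigzag-sews : ∀ {g p n} B V r → Row g p n B V (suc (r + r)) → All (Sews g p n) (zigzag B V r)
zigzag-sews B V zero    _         = []
zigzag-sews {g} {p} {n} B V (suc r) (row cells) =
  lowerSt-sews true  (proj₁ c₁) (proj₂ c₁) ∷ lowerSt-sews false (proj₁ c₂) (proj₂ c₂) ∷
  upperSt-sews false (proj₁ c₀) (proj₂ c₀) ∷ upperSt-sews true  (proj₁ c₁) (proj₂ c₁) ∷
  zigzag-sews (B + 2) V r (row λ i i< → let c = cells (2 + i) (two+ i i<) in
                             subst (_< n) (shift2 i) (proj₁ c) , trans (cong (depth g p) (sym (shift2 i))) (proj₂ c))
  where
  c₀ : B < n × depth g p B ≡ V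
  c₀ = row-head {g} {p} {n} (row cells)
  c₁ = cells 1 (s≤s (s≤s z≤n))
  c₂ = cells 2 (s≤s (s≤s (subst (1 ≤_) (sym (ℕP.+-suc r r)) (s≤s z≤n))))
  shift2 : ∀ i → B + (2 + i) ≡ B + 2 + i
  shift2 i = sym (ℕP.+-assoc B 2 i)
  two+ : ∀ i → i < suc (r + r) → 2 + i < suc (suc r + suc r)
  two+ i i< = s≤s (s≤s (subst (suc i ≤_) (sym (ℕP.+-suc r r)) i<))

zigzag-chain : ∀ B V r → Chain (zigzag B V r)
zigzag-chain B V zero    = tt
zigzag-chain B V (suc r) = right , back , step-east B V , rest r
  where
  right : (B + 1 + 1 , V) ∼ (B + 2 + 1 , V)
  right = east (arith B) refl
    where arith : ∀ B → B + 2 + 1 ≡ suc (B + 1 + 1)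
          arith = solve-∀
  back : (B + 2 , suc V) ∼ (B + 1 , suc V)
  back = west (arith B) refl
    where arith : ∀ B → B + 2 ≡ suc (B + 1)
          arith = solve-∀
  rest : ∀ r → Chain (upperSt (B + 1) V true ∷ zigzag (B + 2) V r)
  rest zero    = tt
  rest (suc r) = east (arith B) refl , zigzag-chain (B + 2) V (suc r)
    where arith : ∀ B → B + 2 + 1 ≡ suc (B + 1 + 1)
          arith = solve-∀

zigzag-last : ∀ B V r →
  to (lastOf (lowerSt (B + 1) V true) (lowerSt (B + 2) V false ∷ upperSt B V false ∷ upperSt (B + 1) V true ∷ zigzag (B + 2) V r))
  ≡ (B + suc (r + suc r) , suc V)
zigzag-last B V zero    = cong (_, suc V) (arith B)
  where arith : ∀ B → B + 1 + 1 ≡ B + suc (0 + 1)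
        arith = solve-∀
zigzag-last B V (suc r) = trans (zigzag-last (B + 2) V r) (cong (_, suc V) (arith B r))
  where arith : ∀ B r → B + 2 + suc (r + suc r) ≡ B + suc (suc r + suc (suc r))
        arith = solve-∀

zigzag-lowerFirst : ∀ Sewn B V r → Sewn (B , lower) → LowerFirst Sewn (zigzag B V r)
zigzag-lowerFirst Sewn B V zero    _    = tt
zigzag-lowerFirst Sewn B V (suc r) sewn =
  (λ ()) , (λ ()) , (λ _ → inj₁ (inj₁ sewn)) , (λ _ → inj₁ (inj₁ (inj₂ refl))) ,
  zigzag-lowerFirst _ (B + 2) V r (inj₁ (inj₁ (inj₂ refl)))

zigzag-coversLower : ∀ B V r i → i < r + r → Covers (zigzag B V r) (B + 1 + i , lower)
zigzag-coversLower B V (suc r) zero          _ = here (cong (_, lower) (sym (ℕP.+-identityʳ (B + 1))))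
zigzag-coversLower B V (suc r) (suc zero)    _ = there (here (cong (_, lower) (arith B)))
  where arith : ∀ B → B + 2 ≡ B + 1 + 1
        arith = solve-∀
zigzag-coversLower B V (suc r) (suc (suc i)) (s≤s i<) =
  there (there (there (there (subst (λ z → Covers (zigzag (B + 2) V r) (z , lower)) (arith B i)
    (zigzag-coversLower (B + 2) V r i (ℕ.s≤s⁻¹ (subst (suc (suc i) ≤_) (ℕP.+-suc r r) i<)))))))
  where arith : ∀ B i → B + 2 + 1 + i ≡ B + 1 + suc (suc i)
        arith = solve-∀

zigzag-coversUpper : ∀ B V r i → i < r + r → Covers (zigzag B V r) (B + i , upper)
zigzag-coversUpper B V (suc r) zero          _ = there (there (here (cong (_, upper) (sym (ℕP.+-identityʳ B)))))
zigzag-coversUpper B V (suc r) (suc zero)    _ = there (there (there (here refl)))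
zigzag-coversUpper B V (suc r) (suc (suc i)) (s≤s i<) =
  there (there (there (there (subst (λ z → Covers (zigzag (B + 2) V r) (z , upper)) (arith B i)
    (zigzag-coversUpper (B + 2) V r i (ℕ.s≤s⁻¹ (subst (suc (suc i) ≤_) (ℕP.+-suc r r) i<)))))))
  where arith : ∀ B i → B + 2 + i ≡ B + suc (suc i)
        arith = solve-∀

landing< : ∀ g p d {m} → m < g + p → m < g + (p + d)
landing< g p d {m} m< = ℕP.<-≤-trans m< (subst (g + p ≤_) (ℕP.+-assoc g p d) (ℕP.m≤m+n (g + p) d))

second< : ∀ g p d {k} → k < d → g + p + k < g + (p + d)
second< g p d {k} k< = subst (g + p + k <_) (ℕP.+-assoc g p d) (ℕP.+-monoʳ-< (g + p) k<)

firstStair : ∀ g p d → Stair g p (g + (p + d)) 0 0 g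
firstStair g p d = stair λ i i< → landing< g p d (ℕP.<-≤-trans i< (ℕP.m≤m+n g p)) , depth-G g p i i<

landingRow : ∀ g p d → Row g p (g + (p + d)) g g p
landingRow g p d = row λ j j< → landing< g p d (ℕP.+-monoʳ-< g j<) , depth-landing g p j j<

secondStair : ∀ g p d → Stair g p (g + (p + d)) (g + p) (suc g) d
secondStair g p d = stair λ k k< → second< g p d k< , depth-second g p k

-- Construction for d = 1 (p ≥ 2): down the first staircase, along the landing
-- with the lower diagonals, the last landing upper diagonal, the single cell
-- of the second staircase, and back along the landing with the upper
-- diagonals, ending at the corner (g , g).  For g = 1 this corner is next to
-- the start (0 , 1).
module OutAndBack (g₁ p₂ : ℕ) where
  g = suc g₁
  p = suc (suc p₂)
  n = g + (p + 1)

  turn : List Stitch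
  turn = upperSt (g + suc p₂) g true ∷ lowerSt (g + p) (suc g) true ∷ upperSt (g + p) (suc g) false ∷ uppersLeft g g (suc p₂)

  plan : List Stitch
  plan = descending 0 0 g ++ (lowersRight g g p ++ turn)

  lastLanding : g + suc p₂ < n × depth g p (g + suc p₂) ≡ g
  lastLanding = row-last (landingRow g p 1)

  secondCell : g + p < n × depth g p (g + p) ≡ suc g
  secondCell = stair-head (secondStair g p 1)

  length≡ : length plan ≡ 2 * n
  length≡ = begin
    length plan                                        ≡⟨ ListP.length-++ (descending 0 0 g) ⟩
    length (descending 0 0 g) + length (lowersRight g g p ++ turn)
      ≡⟨ cong₂ _+_ (descending-length 0 0 g) (ListP.length-++ (lowersRight g g p)) ⟩
    2 * g + (length (lowersRight g g p) + suc (suc (suc (length (uppersLeft g g (suc p₂))))))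
      ≡⟨ cong₂ (λ a b → 2 * g + (a + suc (suc (suc b)))) (lowersRight-length g g p) (uppersLeft-length g g (suc p₂)) ⟩
    2 * g + (p + suc (suc (suc (suc p₂))))             ≡⟨ arith g₁ p₂ ⟩
    2 * n ∎
    where
    open ≡-Reasoning
    arith : ∀ g₁ p₂ → 2 * suc g₁ + (suc (suc p₂) + suc (suc (suc (suc p₂)))) ≡ 2 * (suc g₁ + (suc (suc p₂) + 1))
    arith = solve-∀

  sews : All (Sews g p n) plan
  sews = AllP.++⁺ (descending-sews 0 0 g (firstStair g p 1))
           (AllP.++⁺ (lowersRight-sews g g p (landingRow g p 1))
             (upperSt-sews true (proj₁ lastLanding) (proj₂ lastLanding) ∷
              lowerSt-sews true (proj₁ secondCell) (proj₂ secondCell) ∷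
              upperSt-sews false (proj₁ secondCell) (proj₂ secondCell) ∷
              uppersLeft-sews g g (suc p₂) (row-init (landingRow g p 1))))

  chain : Chain plan
  chain = chain-++ (lowerSt 0 0 true) (upperSt 0 0 true ∷ descending 1 1 g₁) (lowerSt g g true) (lowersRight (suc g) g (suc p₂) ++ turn)
            (descending-chain 0 0 g)
            (chain-++ (lowerSt g g true) (lowersRight (suc g) g (suc p₂)) (upperSt (g + suc p₂) g true) _
               (lowersRight-chain g g p)
               (up , step-south _ _ , west (arith g₁ p₂) refl , uppersLeft-chain g g (suc p₂))
               (∼-cong (sym (lowersRight-last g g (suc p₂))) refl (west (ℕP.+-suc g (suc p₂)) refl)))
            (∼-cong (sym (descending-last 0 0 g₁)) refl (step-south g g))
    where
    arith : ∀ g₁ p₂ → suc g₁ + suc (suc p₂) ≡ suc (suc g₁ + p₂ + 1)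
    arith = solve-∀
    up : (g + suc p₂ + 1 , suc g) ∼ (g + p , suc (suc g))
    up = ∼-cong (cong (_, suc g) (sym (trans (ℕP.+-assoc g (suc p₂) 1) (cong (λ z → g + z) (ℕP.+-comm (suc p₂) 1))))) refl
                (step-south (g + p) (suc g))

  covers : ∀ c δ → c < n → Covers plan (c , δ)
  covers c δ c< with c <? g
  ... | yes c<g = AnyP.++⁺ˡ (descending-covers 0 0 g c δ c<g)
  ... | no  c≮g with c <? g + p
  ...   | yes c<g+p = subst (λ z → Covers plan (z , δ)) (ℕP.m+[n∸m]≡n (ℕP.≮⇒≥ c≮g))
                        (AnyP.++⁺ʳ (descending 0 0 g) (onLanding δ))
    where
    j = c ∸ g
    j<p : j < p
    j<p = ℕP.+-cancelˡ-< g _ _ (subst (_< g + p) (sym (ℕP.m+[n∸m]≡n (ℕP.≮⇒≥ c≮g))) c<g+p)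
    onLanding : ∀ δ → Covers (lowersRight g g p ++ turn) (g + j , δ)
    onLanding lower = AnyP.++⁺ˡ (lowersRight-covers g g p j j<p)
    onLanding upper with ℕP.m≤n⇒m<n∨m≡n (ℕP.≤-pred j<p)
    ... | inj₂ e    = AnyP.++⁺ʳ (lowersRight g g p) (here (cong (λ z → (g + z , upper)) (sym e)))
    ... | inj₁ j<p₁ = AnyP.++⁺ʳ (lowersRight g g p) (there (there (there (uppersLeft-covers g g (suc p₂) j j<p₁))))
  ...   | no  c≮g+p = subst (λ z → Covers plan (z , δ)) c≡
                        (AnyP.++⁺ʳ (descending 0 0 g) (AnyP.++⁺ʳ (lowersRight g g p) (secondCovered δ)))
    where
    c≡ : g + p ≡ c
    c≡ = ℕP.≤-antisym (ℕP.≮⇒≥ c≮g+p) (ℕP.≤-pred (subst (c <_) (trans (sym (ℕP.+-assoc g p 1)) (ℕP.+-comm (g + p) 1)) c<))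
    secondCovered : ∀ δ → Covers turn (g + p , δ)
    secondCovered lower = there (here refl)
    secondCovered upper = there (there (here refl))

  lowerFirst : LowerFirst (λ _ → ⊥) plan
  lowerFirst = lowerFirst-++ _ (descending 0 0 g) (lowersRight g g p ++ turn) (descending-lowerFirst _ 0 0 g)
    (lowerFirst-++ _ (lowersRight g g p) turn (lowersRight-lowerFirst _ g g p)
      ((λ _ → sewnAfter-covers _ (lowersRight g g p) _ (lowersRight-covers g g p (suc p₂) ℕP.≤-refl)) ,
       (λ ()) ,
       (λ _ → inj₂ refl) ,
       uppersLeft-lowerFirst _ g g (suc p₂)
         (λ i i< → inj₁ (inj₁ (inj₁ (sewnAfter-covers _ (lowersRight g g p) _ (lowersRight-covers g g p i (ℕP.<-trans i< (ℕP.n<1+n _)))))))))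

  thePlan : Plan g p 1 plan
  thePlan = record { length≡ = length≡ ; sews = sews ; chain = chain ; covers = covers ; lowerFirst = lowerFirst }

  ends-at-corner : to (nth plan (2 * n ∸ 1)) ≡ (g , g)
  ends-at-corner = begin
    to (nth plan (2 * n ∸ 1))      ≡⟨ cong (λ z → to (nth plan (z ∸ 1))) (sym length≡) ⟩
    to (nth plan (length plan ∸ 1))
      ≡⟨ cong to (nth-last (lowerSt 0 0 true) (upperSt 0 0 true ∷ descending 1 1 g₁ ++ (lowersRight g g p ++ turn))) ⟩
    to (lastOf (lowerSt 0 0 true) (upperSt 0 0 true ∷ descending 1 1 g₁ ++ (lowersRight g g p ++ turn)))
      ≡⟨ cong to (lastOf-++ (lowerSt 0 0 true) (upperSt 0 0 true ∷ descending 1 1 g₁) (lowerSt g g true)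
                            (lowersRight (suc g) g (suc p₂) ++ turn)) ⟩
    to (lastOf (lowerSt g g true) (lowersRight (suc g) g (suc p₂) ++ turn))
      ≡⟨ cong to (lastOf-++ (lowerSt g g true) (lowersRight (suc g) g (suc p₂)) _ _) ⟩
    to (lastOf (upperSt (g + p₂) g false) (uppersLeft g g p₂)) ≡⟨ uppersLeft-last g g p₂ ⟩
    (g , g) ∎
    where open ≡-Reasoning

out-and-back : ∀ g₁ p₂ → Embroiderable (staircase (suc g₁) (suc (suc p₂)) 1)
out-and-back g₁ p₂ = FromPlan.embroidery (OutAndBack.thePlan g₁ p₂)

out-and-back-closed : ∀ p₂ → StronglyEmbroiderable (staircase 1 (suc (suc p₂)) 1)
out-and-back-closed p₂ = FromPlan.strongEmbroidery (OutAndBack.thePlan 0 p₂) (s≤s z≤n)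
  (∼-cong (sym (OutAndBack.ends-at-corner 0 p₂)) refl (west refl refl))

-- Construction for g = 1 (p ≥ 2, d ≥ 1), the mirror image of the previous
-- one: up the second staircase from its bottom cell, along the landing with
-- the lower diagonals, the first landing upper diagonal, the single cell of
-- the first staircase, and along the landing with the upper diagonals.
module InAndOut (p₂ d₁ : ℕ) where
  g = 1
  p = suc (suc p₂)
  d = suc d₁
  n = g + (p + d)

  turn : List Stitch
  turn = upperSt 1 1 false ∷ lowerSt 0 0 false ∷ upperSt 0 0 true ∷ uppersRight 2 1 (suc p₂)

  plan : List Stitch
  plan = ascending (1 + p) 2 d ++ (lowersLeft 1 1 p ++ turn)

  firstLanding : 1 < n × depth g p 1 ≡ 1
  firstLanding = row-head (landingRow g p d)

  firstCell : 0 < n × depth g p 0 ≡ 0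
  firstCell = stair-head (firstStair g p d)

  length≡ : length plan ≡ 2 * n
  length≡ = begin
    length plan ≡⟨ ListP.length-++ (ascending (1 + p) 2 d) ⟩
    length (ascending (1 + p) 2 d) + length (lowersLeft 1 1 p ++ turn)
      ≡⟨ cong₂ _+_ (ascending-length (1 + p) 2 d) (ListP.length-++ (lowersLeft 1 1 p)) ⟩
    2 * d + (length (lowersLeft 1 1 p) + suc (suc (suc (length (uppersRight 2 1 (suc p₂))))))
      ≡⟨ cong₂ (λ a b → 2 * d + (a + suc (suc (suc b)))) (lowersLeft-length 1 1 p) (uppersRight-length 2 1 (suc p₂)) ⟩
    2 * d + (p + suc (suc (suc (suc p₂)))) ≡⟨ arith p₂ d₁ ⟩
    2 * n ∎
    where
    open ≡-Reasoning
    arith : ∀ p₂ d₁ → 2 * suc d₁ + (suc (suc p₂) + suc (suc (suc (suc p₂)))) ≡ 2 * (1 + (suc (suc p₂) + suc d₁))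
    arith = solve-∀

  sews : All (Sews g p n) plan
  sews = AllP.++⁺ (ascending-sews (1 + p) 2 d (secondStair g p d))
           (AllP.++⁺ (lowersLeft-sews 1 1 p (landingRow g p d))
             (upperSt-sews false (proj₁ firstLanding) (proj₂ firstLanding) ∷
              lowerSt-sews false (proj₁ firstCell) (proj₂ firstCell) ∷
              upperSt-sews true (proj₁ firstCell) (proj₂ firstCell) ∷
              uppersRight-sews 2 1 (suc p₂) (row-tail (landingRow g p d))))

  chain : Chain plan
  chain = chain-++ (lowerSt (1 + p + d₁) (2 + d₁) false) (upperSt (1 + p + d₁) (2 + d₁) false ∷ ascending (1 + p) 2 d₁)
                   (lowerSt (1 + suc p₂) 1 false) (lowersLeft 1 1 (suc p₂) ++ turn)
            (ascending-chain (1 + p) 2 d)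
            (chain-++ (lowerSt (1 + suc p₂) 1 false) (lowersLeft 1 1 (suc p₂)) (upperSt 1 1 false) _
               (lowersLeft-chain 1 1 p)
               (step-north 1 0 , step-north 0 0 , step-east 1 1 , uppersRight-chain 2 1 (suc p₂))
               (∼-cong (sym (lowersLeft-last 1 1 (suc p₂))) refl (step-east 1 2)))
            (∼-cong (sym (ascending-last (1 + p) 2 d₁)) refl (∼-cong (cong (_, 2) (arith p₂)) refl (step-north (1 + suc p₂ + 1) 1)))
    where arith : ∀ p₂ → 1 + suc p₂ + 1 ≡ 1 + suc (suc p₂) + 0
          arith = solve-∀

  covers : ∀ c δ → c < n → Covers plan (c , δ)
  covers zero lower _ = AnyP.++⁺ʳ (ascending (1 + p) 2 d) (AnyP.++⁺ʳ (lowersLeft 1 1 p) (there (here refl)))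
  covers zero upper _ = AnyP.++⁺ʳ (ascending (1 + p) 2 d) (AnyP.++⁺ʳ (lowersLeft 1 1 p) (there (there (here refl))))
  covers (suc c) δ c< with c <? p
  covers (suc c)       lower c< | yes c<p = AnyP.++⁺ʳ (ascending (1 + p) 2 d) (AnyP.++⁺ˡ (lowersLeft-covers 1 1 p c c<p))
  covers (suc zero)    upper c< | yes _   = AnyP.++⁺ʳ (ascending (1 + p) 2 d) (AnyP.++⁺ʳ (lowersLeft 1 1 p) (here refl))
  covers (suc (suc j)) upper c< | yes c<p =
    AnyP.++⁺ʳ (ascending (1 + p) 2 d) (AnyP.++⁺ʳ (lowersLeft 1 1 p) (there (there (there (uppersRight-covers 2 1 (suc p₂) j (ℕP.≤-pred c<p))))))
  covers (suc c) δ c< | no c≮p = subst (λ z → Covers plan (z , δ)) c≡ (AnyP.++⁺ˡ (ascending-covers (1 + p) 2 d k δ k<d))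
    where
    k = c ∸ p
    c≡ : 1 + p + k ≡ suc c
    c≡ = cong suc (ℕP.m+[n∸m]≡n (ℕP.≮⇒≥ c≮p))
    k<d : k < d
    k<d = ℕP.+-cancelˡ-< (1 + p) _ _ (subst (_< 1 + p + d) (sym c≡) (subst (suc c <_) (sym (ℕP.+-assoc 1 p d)) c<))

  lowerFirst : LowerFirst (λ _ → ⊥) plan
  lowerFirst = lowerFirst-++ _ (ascending (1 + p) 2 d) (lowersLeft 1 1 p ++ turn) (ascending-lowerFirst _ (1 + p) 2 d)
    (lowerFirst-++ _ (lowersLeft 1 1 p) turn (lowersLeft-lowerFirst _ 1 1 p)
      ((λ _ → sewnAfter-covers _ (lowersLeft 1 1 p) _ (lowersLeft-covers 1 1 p 0 (s≤s z≤n))) ,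
       (λ ()) ,
       (λ _ → inj₂ refl) ,
       uppersRight-lowerFirst _ 2 1 (suc p₂)
         (λ i i< → inj₁ (inj₁ (inj₁ (sewnAfter-covers _ (lowersLeft 1 1 p) _ (lowersLeft-covers 1 1 p (suc i) (s≤s i<))))))))

  thePlan : Plan g p d plan
  thePlan = record { length≡ = length≡ ; sews = sews ; chain = chain ; covers = covers ; lowerFirst = lowerFirst }

in-and-out : ∀ p₂ d₁ → Embroiderable (staircase 1 (suc (suc p₂)) (suc d₁))
in-and-out p₂ d₁ = FromPlan.embroidery (InAndOut.thePlan p₂ d₁)

-- Construction for odd p = 2r + 1 (r ≥ 1): down the first staircase, across
-- the landing (its first lower diagonal, a zigzag, its last upper diagonal),
-- and down the second staircase.
module Across (g₁ r₁ d₁ : ℕ) where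
  g = suc g₁
  r = suc r₁
  p = suc (r + r)
  d = suc d₁
  n = g + (p + d)

  down : List Stitch
  down = upperSt (g + (r + r)) g true ∷ descending (g + p) (suc g) d

  plan : List Stitch
  plan = descending 0 0 g ++ (lowerSt g g true ∷ (zigzag g g r ++ down))

  firstLanding : g < n × depth g p g ≡ g
  firstLanding = row-head (landingRow g p d)

  lastLanding : g + (r + r) < n × depth g p (g + (r + r)) ≡ g
  lastLanding = row-last (landingRow g p d)

  length≡ : length plan ≡ 2 * n
  length≡ = begin
    length plan ≡⟨ ListP.length-++ (descending 0 0 g) ⟩
    length (descending 0 0 g) + suc (length (zigzag g g r ++ down))
      ≡⟨ cong₂ (λ a b → a + suc b) (descending-length 0 0 g) (ListP.length-++ (zigzag g g r)) ⟩
    2 * g + suc (length (zigzag g g r) + suc (length (descending (g + p) (suc g) d)))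
      ≡⟨ cong₂ (λ a b → 2 * g + suc (a + suc b)) (zigzag-length g g r) (descending-length (g + p) (suc g) d) ⟩
    2 * g + suc (4 * r + suc (2 * d)) ≡⟨ arith g₁ r₁ d₁ ⟩
    2 * n ∎
    where
    open ≡-Reasoning
    arith : ∀ g₁ r₁ d₁ → 2 * suc g₁ + suc (4 * suc r₁ + suc (2 * suc d₁)) ≡ 2 * (suc g₁ + (suc (suc r₁ + suc r₁) + suc d₁))
    arith = solve-∀

  sews : All (Sews g p n) plan
  sews = AllP.++⁺ (descending-sews 0 0 g (firstStair g p d))
           (lowerSt-sews true (proj₁ firstLanding) (proj₂ firstLanding) ∷
            AllP.++⁺ (zigzag-sews g g r (landingRow g p d))
              (upperSt-sews true (proj₁ lastLanding) (proj₂ lastLanding) ∷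
               descending-sews (g + p) (suc g) d (secondStair g p d)))

  chain : Chain plan
  chain = chain-++ (lowerSt 0 0 true) (upperSt 0 0 true ∷ descending 1 1 g₁) (lowerSt g g true) (zigzag g g r ++ down)
            (descending-chain 0 0 g)
            (step-south (g + 1) g ,
             chain-++ (lowerSt (g + 1) g true) (lowerSt (g + 2) g false ∷ upperSt g g false ∷ upperSt (g + 1) g true ∷ zigzag (g + 2) g r₁)
                      (upperSt (g + (r + r)) g true) (descending (g + p) (suc g) d)
               (zigzag-chain g g r)
               (∼-cong (cong (_, suc g) (sym (arith g₁ r₁))) refl (step-south (g + p) (suc g)) , descending-chain (g + p) (suc g) d)
               (∼-cong (sym (zigzag-last g g r₁)) refl (step-north _ g)))
            (∼-cong (sym (descending-last 0 0 g₁)) refl (step-south g g))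
    where arith : ∀ g₁ r₁ → suc g₁ + (suc r₁ + suc r₁) + 1 ≡ suc g₁ + suc (suc r₁ + suc r₁)
          arith = solve-∀

  covers : ∀ c δ → c < n → Covers plan (c , δ)
  covers c δ c< with c <? g
  ... | yes c<g = AnyP.++⁺ˡ (descending-covers 0 0 g c δ c<g)
  ... | no  c≮g with c <? g + p
  ...   | yes c<g+p = subst (λ z → Covers plan (z , δ)) c≡ (AnyP.++⁺ʳ (descending 0 0 g) (onLanding j δ j<p))
    where
    j = c ∸ g
    c≡ : g + j ≡ c
    c≡ = ℕP.m+[n∸m]≡n (ℕP.≮⇒≥ c≮g)
    j<p : j < p
    j<p = ℕP.+-cancelˡ-< g _ _ (subst (_< g + p) (sym c≡) c<g+p)
    onLanding : ∀ j δ → j < p → Covers (lowerSt g g true ∷ (zigzag g g r ++ down)) (g + j , δ)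
    onLanding zero     lower _ = here (cong (_, lower) (sym (ℕP.+-identityʳ g)))
    onLanding (suc j′) lower (s≤s j′<) =
      there (AnyP.++⁺ˡ (subst (λ z → Covers (zigzag g g r) (z , lower)) (arith g j′) (zigzag-coversLower g g r j′ j′<)))
      where arith : ∀ g j′ → g + 1 + j′ ≡ g + suc j′
            arith = solve-∀
    onLanding j upper j< with ℕP.m≤n⇒m<n∨m≡n (ℕP.≤-pred j<)
    ... | inj₁ j<2r = there (AnyP.++⁺ˡ (zigzag-coversUpper g g r j j<2r))
    ... | inj₂ refl = there (AnyP.++⁺ʳ (zigzag g g r) (here refl))
  ...   | no  c≮g+p = subst (λ z → Covers plan (z , δ)) c≡
                        (AnyP.++⁺ʳ (descending 0 0 g) (there (AnyP.++⁺ʳ (zigzag g g r) (there (descending-covers (g + p) (suc g) d k δ k<d)))))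
    where
    k = c ∸ (g + p)
    c≡ : g + p + k ≡ c
    c≡ = ℕP.m+[n∸m]≡n (ℕP.≮⇒≥ c≮g+p)
    k<d : k < d
    k<d = ℕP.+-cancelˡ-< (g + p) _ _ (subst (_< g + p + d) (sym c≡) (subst (c <_) (sym (ℕP.+-assoc g p d)) c<))

  lowerFirst : LowerFirst (λ _ → ⊥) plan
  lowerFirst = lowerFirst-++ _ (descending 0 0 g) _ (descending-lowerFirst _ 0 0 g)
    ((λ ()) ,
     lowerFirst-++ _ (zigzag g g r) down (zigzag-lowerFirst _ g g r (inj₂ refl))
       ((λ _ → sewnAfter-covers _ (zigzag g g r) _
                 (subst (λ z → Covers (zigzag g g r) (z , lower)) (arith g₁ r₁) (zigzag-coversLower g g r (r₁ + suc r₁) ℕP.≤-refl))) ,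
        descending-lowerFirst _ (g + p) (suc g) d))
    where arith : ∀ g₁ r₁ → suc g₁ + 1 + (r₁ + suc r₁) ≡ suc g₁ + (suc r₁ + suc r₁)
          arith = solve-∀

  thePlan : Plan g p d plan
  thePlan = record { length≡ = length≡ ; sews = sews ; chain = chain ; covers = covers ; lowerFirst = lowerFirst }

across : ∀ g₁ r₁ d₁ → Embroiderable (staircase (suc g₁) (suc (suc r₁ + suc r₁)) (suc d₁))
across g₁ r₁ d₁ = FromPlan.embroidery (Across.thePlan g₁ r₁ d₁)

even?-false⇒odd : ∀ n → even? n ≡ false → n % 2 ≡ 1
even?-false⇒odd (suc zero)    _ = refl
even?-false⇒odd (suc (suc n)) e = even?-false⇒odd n (trans (sym (not-involutive (even? n))) e)

odd⇒double+1 : ∀ n → n % 2 ≡ 1 → ∃ λ r → n ≡ suc (r + r)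
odd⇒double+1 (suc zero)    _ = 0 , refl
odd⇒double+1 (suc (suc n)) e with odd⇒double+1 n e
... | r , refl = suc r , cong (λ z → suc (suc z)) (sym (ℕP.+-suc r r))

case-i : ∀ g p d → 2 ≤ p → g ≡ 1 → d ≡ 1 → StronglyEmbroiderable (staircase g p d)
case-i _ (suc (suc p₂)) _ (s≤s (s≤s z≤n)) refl refl = out-and-back-closed p₂

case-ii : ∀ g p d → 2 ≤ p → g ≡ 1 → 1 < d →
          Embroiderable (staircase g p d) × ¬ StronglyEmbroiderable (staircase g p d)
case-ii _ (suc (suc p₂)) (suc (suc d₂)) (s≤s (s≤s z≤n)) refl (s≤s (s≤s z≤n)) =
  in-and-out p₂ (suc d₂) , not-strongly-last 0 (suc p₂) d₂

case-iii : ∀ g p d → 2 ≤ p → d ≡ 1 → 1 < g →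
           Embroiderable (staircase g p d) × ¬ StronglyEmbroiderable (staircase g p d)
case-iii (suc (suc g₂)) (suc (suc p₂)) _ (s≤s (s≤s z≤n)) refl (s≤s (s≤s z≤n)) =
  out-and-back (suc g₂) p₂ , not-strongly-first g₂ (suc p₂) 1

case-iv : ∀ g p d → 2 ≤ p → 1 < g → 1 < d →
          ¬ StronglyEmbroiderable (staircase g p d) × (Embroiderable (staircase g p d) ⇔ (p % 2 ≡ 1))
case-iv (suc (suc g₂)) (suc p₁) (suc (suc d₂)) (s≤s (s≤s z≤n)) (s≤s (s≤s z≤n)) (s≤s (s≤s z≤n)) =
  not-strongly-first g₂ p₁ (suc (suc d₂)) , mk⇔ onlyIfOdd ifOdd
  where
  p = suc p₁
  onlyIfOdd : Embroiderable (staircase (2 + g₂) p (2 + d₂)) → p % 2 ≡ 1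
  onlyIfOdd em = even?-false⇒odd p (odd-landing g₂ p₁ d₂ em)
  ifOdd : p % 2 ≡ 1 → Embroiderable (staircase (2 + g₂) p (2 + d₂))
  ifOdd odd with odd⇒double+1 p odd
  ... | suc r₁ , p≡ = subst (λ q → Embroiderable (staircase (2 + g₂) q (2 + d₂))) (sym p≡) (across (suc g₂) r₁ (suc d₂))

mainTheorem4 : (g p d : ℕ) → 1 ≤ g → 2 ≤ p → 1 ≤ d →
    (g ≡ 1 → d ≡ 1 → StronglyEmbroiderable (staircase g p d))
    × (g ≡ 1 → 1 < d → Embroiderable (staircase g p d) × ¬ StronglyEmbroiderable (staircase g p d))
    × (d ≡ 1 → 1 < g → Embroiderable (staircase g p d) × ¬ StronglyEmbroiderable (staircase g p d))
    × (1 < g → 1 < d → ¬ StronglyEmbroiderable (staircase g p d) × (Embroiderable (staircase g p d) ⇔ (p % 2 ≡ 1)))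
mainTheorem4 g p d _ p≥2 _ = case-i g p d p≥2 , case-ii g p d p≥2 , case-iii g p d p≥2 , case-iv g p d p≥2
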